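{- Let $M$ be an even $\Delta$-matroid on a ground set of at most $5$ elements. Then $M$ is representable over every algebraically closed field of characteristic $0$.
   Context: A $\Delta$-matroid is a pair $(E,\mathcal{B})$ with $E$ finite and $\mathcal{B}$ a nonempty family of subsets of $E$ (bases) such that for all $A,B\in\mathcal{B}$ and $a\in A\Delta B$ there is $b\in A\Delta B$ with $A\Delta\{a,b\}\in\mathcal{B}$. It is an even $\Delta$-matroid if moreover $b$ can always be chosen with $b\neq a$. Representability over a field $K$ (ground set $[n]$): let $V=K^{2n}$ with coordinates indexed by $1,\dots,n,1^*,\dots,n^*$ and symmetric bilinear form $Q(x,y)=\sum_{i=1}^n(x_iy_{i^*}+x_{i^*}y_i)$. An $n$-dimensional subspace $U$ is isotropic if $Q(u,v)=0$ for all $u,v\in U$. Its Wick coordinates $w\in\mathbb{P}^{2^n-1}$, indexed by subsets of $[n]$, are defined as follows: after swapping the columns $j$ and $j^*$ for all $j$ in some $J\subseteq[n]$, a matrix whose row space is $U$ can be row-reduced to $[I\,|\,A]$ with $A$ skew-symmetric; then $w_{[n]\setminus S}=\pm\mathrm{pf}(A_{S\Delta J})$ if $|S\Delta J|$ is even and $w_{[n]\setminus S}=0$ otherwise, where $A_X$ is the principal submatrix on rows/columns $X$ and $\mathrm{pf}$ the Pfaffian (the signs depend only on $S,J$). The set $\{S: w_S\neq0\}$ is the set of bases of an even $\Delta$-matroid; an even $\Delta$-matroid over $[n]$ is representable over $K$ if it arises this way from some $n$-dimensional isotropic subspace of $K^{2n}$. -}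

module Defs where

open import Level using (Level; _⊔_)
open import Algebra.Bundles using (CommutativeRing)
open import Data.Nat using (ℕ; zero; suc; _≤_)
open import Data.Bool using (Bool; true; false; _xor_)
open import Data.Fin as Fin using (Fin; toℕ)
open import Data.Fin.Subset using (Subset; _∈_; ⁅_⁆; _∪_; ∁)
open import Data.Vec as Vec using (Vec; []; _∷_; zipWith; removeAt)
open import Data.List using (List; []; _∷_)
open import Data.Product using (Σ; ∃; _×_; _,_)
open import Relation.Nullary using (¬_)
open import Relation.Binary.PropositionalEquality using (_≡_; _≢_)
open import Function.Bundles using (_⇔_)

record Field (c ℓ : Level) : Set (Level.suc (c ⊔ ℓ)) where
  field
    commutativeRing : CommutativeRing c ℓ
  open CommutativeRing commutativeRing public
  field
    0≉1     : ¬ (0# ≈ 1#)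
    inverse : ∀ x → ¬ (x ≈ 0#) → ∃ λ y → x * y ≈ 1#

isEven : ℕ → Bool
isEven zero          = true
isEven (suc zero)    = false
isEven (suc (suc n)) = isEven n

module _ {c ℓ} (K : Field c ℓ) where
  open Field K

  natK : ℕ → Carrier
  natK zero    = 0#
  natK (suc n) = 1# + natK n

  CharacteristicZero : Set ℓ
  CharacteristicZero = ∀ n → ¬ (natK (suc n) ≈ 0#)

  -- polynomial evaluation, coefficients listed from the constant term upward
  evalPoly : List Carrier → Carrier → Carrier
  evalPoly []       x = 0#
  evalPoly (a ∷ as) x = a + x * evalPoly as x

  -- algebraically closed: every monic polynomial of degree ≥ 1,
  --   c₀ + c₁ X + … + c_{d-1} X^{d-1} + X^d  (d ≥ 1),
  -- has a root in K
  AlgebraicallyClosed : Set (c ⊔ ℓ)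
  AlgebraicallyClosed =
    ∀ (c₀ : Carrier) (cs : List Carrier) →
      ∃ λ x → evalPoly (c₀ ∷ cs Data.List.++ (1# ∷ [])) x ≈ 0#

  SkewSymmetric : ∀ {n} → (Fin n → Fin n → Carrier) → Set ℓ
  SkewSymmetric A = (∀ i j → A i j ≈ - A j i) × (∀ i → A i i ≈ 0#)

  pfVec : ∀ {n k} → (Fin n → Fin n → Carrier) → Vec (Fin n) k → Carrier
  pfVec A []           = 1#
  pfVec A (x ∷ [])     = 0#
  pfVec A (x ∷ y ∷ ys) =
    sumFin (λ i → sgn i (A x (Vec.lookup (y ∷ ys) i) * pfVec A (removeAt (y ∷ ys) i)))
    where
      sgn : ∀ {m} → Fin m → Carrier → Carrier
      sgn i a with isEven (toℕ i)
      ... | true  = a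
      ... | false = - a
      sumFin : ∀ {m} → (Fin m → Carrier) → Carrier
      sumFin {zero}  f = 0#
      sumFin {suc m} f = f Fin.zero + sumFin (λ i → f (Fin.suc i))

  -- the Pfaffian pf(A_X) of the principal submatrix on X ⊆ [n]
  -- (indices of X taken in increasing order)
  pf : ∀ {n} → (Fin n → Fin n → Carrier) → Subset n → Carrier
  pf {n} A X = pfVec A (Vec.fromList (elems X))
    where
      elems : ∀ {m} → Subset m → List (Fin m)
      elems []          = []
      elems (true ∷ s)  = Fin.zero ∷ Data.List.map Fin.suc (elems s)
      elems (false ∷ s) = Data.List.map Fin.suc (elems s)

-- Δ-matroids on the ground set [n] = Fin n; a family of subsets of [n]
-- is given by its (decidable) indicator  𝓑 : Subset n → Bool

_Δ_ : ∀ {n} → Subset n → Subset n → Subset n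
_Δ_ = zipWith _xor_

IsDeltaMatroid : ∀ {n} → (Subset n → Bool) → Set
IsDeltaMatroid {n} 𝓑 =
  (∃ λ B → 𝓑 B ≡ true) ×
  (∀ A B → 𝓑 A ≡ true → 𝓑 B ≡ true → ∀ a → a ∈ (A Δ B) →
     ∃ λ b → b ∈ (A Δ B) × 𝓑 (A Δ (⁅ a ⁆ ∪ ⁅ b ⁆)) ≡ true)

IsEvenDeltaMatroid : ∀ {n} → (Subset n → Bool) → Set
IsEvenDeltaMatroid {n} 𝓑 =
  IsDeltaMatroid 𝓑 ×
  (∀ A B → 𝓑 A ≡ true → 𝓑 B ≡ true → ∀ a → a ∈ (A Δ B) →
     ∃ λ b → b ∈ (A Δ B) × b ≢ a × 𝓑 (A Δ (⁅ a ⁆ ∪ ⁅ b ⁆)) ≡ true)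

-- Representability: an isotropic subspace is given (in the chart obtained
-- after swapping columns j, j* for j ∈ J) by a skew-symmetric matrix A with
-- row space of [I | A]; its Wick coordinates are w_{[n]∖S} = ± pf(A_{S Δ J})
-- (0 when |S Δ J| is odd, which pf already returns).  The represented
-- even Δ-matroid has bases {T : w_T ≠ 0}.

module _ {c ℓ} (K : Field c ℓ) where
  open Field K

  RepresentableOver : ∀ {n} → (Subset n → Bool) → Set (c ⊔ ℓ)
  RepresentableOver {n} 𝓑 =
    Σ (Subset n) λ J →
    Σ (Fin n → Fin n → Carrier) λ A →
      SkewSymmetric K A ×
      (∀ T → (𝓑 T ≡ true) ⇔ (¬ (pf K A ((∁ T) Δ J) ≈ 0#)))

module Submission where

-- Translating an even Δ-matroid by one of its bases B₀ (X ↦ X Δ B₀) gives an even Δ-matroid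
-- having ⊥ as a basis, so all of its bases are even.  For n ≤ 5 there are only finitely many
-- families of even sets containing ⊥, and an exhaustive computation shows that each of them
-- either violates one of a short list of exchange instances, or is exactly the set of X with
-- pf(W_X) ≠ 0 for an explicitly given skew-symmetric integer matrix W.  In characteristic 0 an
-- integer vanishes in K only if it is 0, and translating back by B₀ is the change of chart
-- J = ∁ B₀, because ∁ T Δ ∁ B₀ = T Δ B₀.

open import Defs
open import Level using (Level)
open import Algebra.Bundles using (CommutativeRing)
import Algebra.Properties.AbelianGroup as AbelianGroupProperties
import Algebra.Properties.CommutativeSemigroup as CommutativeSemigroupProperties
import Algebra.Properties.Group as GroupProperties
open import Data.Bool using (Bool; true; false; not; _∧_; _∨_; _xor_; T)
open import Data.Bool.ListAction using (any; all)
open import Data.Bool.Properties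
  using (xor-assoc; xor-comm; xor-identityˡ; xor-identityʳ; xor-same; xor-annihilates-not;
         xor-∧-commutativeRing; not-involutive; T-∧; T-≡)
  renaming (_≟_ to _≟ᵇ_)
open import Data.Empty using () renaming (⊥-elim to contradiction⊥)
open import Data.Fin as Fin using (Fin; zero; suc; toℕ; #_)
open import Data.Fin.Subset using (Subset; _∈_; ⁅_⁆; _∪_; ∁; ⊥; ∣_∣)
open import Data.Fin.Subset.Properties using (nonempty?; Empty-unique; ∪-identityˡ; ∪-identityʳ)
open import Data.List as List using (List; []; _∷_)
open import Data.List.Membership.Propositional using (lose)
open import Data.List.Membership.Propositional.Properties using (∈-allFin)
import Data.List.Relation.Unary.All as All
open import Data.List.Relation.Unary.All.Properties using (all⁻)
open import Data.List.Relation.Unary.Any.Properties using (any⁺)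
open import Data.Maybe using (Maybe; just; nothing; maybe)
open import Data.Nat as ℕ using (ℕ; zero; suc; _≤_; _<_; _<?_; _≤?_; s≤s; _^_; _/_; _%_; _≡ᵇ_)
open import Data.Nat.Induction using (<-wellFounded)
open import Data.Nat.Properties using (≤-reflexive; <-trans; m^n≢0; ≡ᵇ⇒≡; ≡⇒≡ᵇ)
open import Data.Product using (∃; _×_; _,_; proj₁; proj₂)
open import Data.Unit using (tt)
open import Data.Vec as Vec using (Vec; []; _∷_; here; there; lookup; removeAt; foldr′)
open import Data.Vec.Properties
  using (zipWith-assoc; zipWith-comm; zipWith-identityˡ; zipWith-identityʳ; []=⇒lookup; lookup⇒[]=)
open import Function using (_∘_; _⇔_; mk⇔; Equivalence)
open import Induction.WellFounded using (Acc; acc)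
open import Relation.Binary.PropositionalEquality
  using (_≡_; _≢_; refl; sym; trans; cong; cong₂; subst; module ≡-Reasoning)
open import Relation.Nullary using (¬_; yes; no; does)
open import Relation.Nullary.Decidable using (True; ⌊_⌋; toWitness; dec-false)

module _ {n : ℕ} where

  Δ-assoc : ∀ (X Y Z : Subset n) → (X Δ Y) Δ Z ≡ X Δ (Y Δ Z)
  Δ-assoc = zipWith-assoc xor-assoc

  Δ-comm : ∀ (X Y : Subset n) → X Δ Y ≡ Y Δ X
  Δ-comm = zipWith-comm xor-comm

  Δ-identityˡ : ∀ (X : Subset n) → ⊥ Δ X ≡ X
  Δ-identityˡ = zipWith-identityˡ xor-identityˡ

  Δ-identityʳ : ∀ (X : Subset n) → X Δ ⊥ ≡ X
  Δ-identityʳ = zipWith-identityʳ xor-identityʳ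

Δ-self : ∀ {n} (X : Subset n) → X Δ X ≡ ⊥
Δ-self []      = refl
Δ-self (x ∷ X) = cong₂ _∷_ (xor-same x) (Δ-self X)

∁-Δ-∁ : ∀ {n} (X Y : Subset n) → ∁ X Δ ∁ Y ≡ X Δ Y
∁-Δ-∁ []      []      = refl
∁-Δ-∁ (x ∷ X) (y ∷ Y) = cong₂ _∷_ (xor-annihilates-not x y) (∁-Δ-∁ X Y)

module _ {n : ℕ} where

  Δ-swapʳ : ∀ (X Y Z : Subset n) → (X Δ Y) Δ Z ≡ (X Δ Z) Δ Y
  Δ-swapʳ X Y Z = begin
    (X Δ Y) Δ Z   ≡⟨ Δ-assoc X Y Z ⟩
    X Δ (Y Δ Z)   ≡⟨ cong (X Δ_) (Δ-comm Y Z) ⟩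
    X Δ (Z Δ Y)   ≡⟨ Δ-assoc X Z Y ⟨
    (X Δ Z) Δ Y   ∎
    where open ≡-Reasoning

  Δ-cancelʳ : ∀ (X Y : Subset n) → (X Δ Y) Δ Y ≡ X
  Δ-cancelʳ X Y = begin
    (X Δ Y) Δ Y   ≡⟨ Δ-assoc X Y Y ⟩
    X Δ (Y Δ Y)   ≡⟨ cong (X Δ_) (Δ-self Y) ⟩
    X Δ ⊥         ≡⟨ Δ-identityʳ X ⟩
    X             ∎
    where open ≡-Reasoning

  Δ-Δ-cancelʳ : ∀ (X Y Z : Subset n) → (X Δ Z) Δ (Y Δ Z) ≡ X Δ Y
  Δ-Δ-cancelʳ X Y Z = begin
    (X Δ Z) Δ (Y Δ Z)   ≡⟨ Δ-assoc (X Δ Z) Y Z ⟨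
    ((X Δ Z) Δ Y) Δ Z   ≡⟨ cong (_Δ Z) (Δ-swapʳ X Z Y) ⟩
    ((X Δ Y) Δ Z) Δ Z   ≡⟨ Δ-cancelʳ (X Δ Y) Z ⟩
    X Δ Y               ∎
    where open ≡-Reasoning

  Δ≡⊥⇒≡ : ∀ {X Y : Subset n} → X Δ Y ≡ ⊥ → X ≡ Y
  Δ≡⊥⇒≡ {X} {Y} X-Y≡⊥ = begin
    X             ≡⟨ Δ-cancelʳ X Y ⟨
    (X Δ Y) Δ Y   ≡⟨ cong (_Δ Y) X-Y≡⊥ ⟩
    ⊥ Δ Y         ≡⟨ Δ-identityˡ Y ⟩
    Y             ∎
    where open ≡-Reasoning

⁅⁆∪⁅⁆≡⁅⁆Δ⁅⁆ : ∀ {n} {a b : Fin n} → a ≢ b → ⁅ a ⁆ ∪ ⁅ b ⁆ ≡ ⁅ a ⁆ Δ ⁅ b ⁆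
⁅⁆∪⁅⁆≡⁅⁆Δ⁅⁆ {a = zero}  {zero}  a≢b = contradiction⊥ (a≢b refl)
⁅⁆∪⁅⁆≡⁅⁆Δ⁅⁆ {a = zero}  {suc b} _   =
  cong (true ∷_) (trans (∪-identityˡ ⁅ b ⁆) (sym (Δ-identityˡ ⁅ b ⁆)))
⁅⁆∪⁅⁆≡⁅⁆Δ⁅⁆ {a = suc a} {zero}  _   =
  cong (true ∷_) (trans (∪-identityʳ ⁅ a ⁆) (sym (Δ-identityʳ ⁅ a ⁆)))
⁅⁆∪⁅⁆≡⁅⁆Δ⁅⁆ {a = suc a} {suc b} a≢b = cong (false ∷_) (⁅⁆∪⁅⁆≡⁅⁆Δ⁅⁆ (a≢b ∘ cong suc))

∣Δ⁅⁆∣ : ∀ {n} {a : Fin n} {X : Subset n} → a ∈ X → suc ∣ X Δ ⁅ a ⁆ ∣ ≡ ∣ X ∣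
∣Δ⁅⁆∣ {X = true  ∷ X} here        = cong (suc ∘ ∣_∣) (Δ-identityʳ X)
∣Δ⁅⁆∣ {X = true  ∷ X} (there a∈X) = cong suc (∣Δ⁅⁆∣ a∈X)
∣Δ⁅⁆∣ {X = false ∷ X} (there a∈X) = ∣Δ⁅⁆∣ a∈X

∈-Δ⁅⁆ : ∀ {n} {a b : Fin n} {X : Subset n} → b ∈ X → b ≢ a → b ∈ X Δ ⁅ a ⁆
∈-Δ⁅⁆ {a = zero}  here        b≢a = contradiction⊥ (b≢a refl)
∈-Δ⁅⁆ {a = zero}  (there b∈X) _   = there (subst (_ ∈_) (sym (Δ-identityʳ _)) b∈X)
∈-Δ⁅⁆ {a = suc a} here        _   = here
∈-Δ⁅⁆ {a = suc a} (there b∈X) b≢a = there (∈-Δ⁅⁆ b∈X (b≢a ∘ cong suc))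

∣Δ⁅⁆∪⁅⁆∣< : ∀ {n} {a b : Fin n} {X : Subset n} → a ∈ X → b ∈ X → a ≢ b →
             ∣ X Δ (⁅ a ⁆ ∪ ⁅ b ⁆) ∣ < ∣ X ∣
∣Δ⁅⁆∪⁅⁆∣< {a = a} {b} {X} a∈X b∈X a≢b =
  subst (_< ∣ X ∣) (cong ∣_∣ X-a-b≡X-ab)
    (<-trans (≤-reflexive (∣Δ⁅⁆∣ (∈-Δ⁅⁆ b∈X (a≢b ∘ sym)))) (≤-reflexive (∣Δ⁅⁆∣ a∈X)))
  where
    X-a-b≡X-ab : (X Δ ⁅ a ⁆) Δ ⁅ b ⁆ ≡ X Δ (⁅ a ⁆ ∪ ⁅ b ⁆)
    X-a-b≡X-ab = trans (Δ-assoc X ⁅ a ⁆ ⁅ b ⁆) (cong (X Δ_) (sym (⁅⁆∪⁅⁆≡⁅⁆Δ⁅⁆ a≢b)))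

parity : ∀ {n} → Subset n → Bool
parity = foldr′ _xor_ false

parity-⊥ : ∀ n → parity (⊥ {n}) ≡ false
parity-⊥ zero    = refl
parity-⊥ (suc n) = parity-⊥ n

parity-⁅⁆ : ∀ {n} (a : Fin n) → parity ⁅ a ⁆ ≡ true
parity-⁅⁆ {suc n} zero = cong not (parity-⊥ n)
parity-⁅⁆ (suc a)      = parity-⁅⁆ a

parity-Δ : ∀ {n} (X Y : Subset n) → parity (X Δ Y) ≡ parity X xor parity Y
parity-Δ []      []      = refl
parity-Δ (x ∷ X) (y ∷ Y) = begin
  (x xor y) xor parity (X Δ Y)            ≡⟨ cong ((x xor y) xor_) (parity-Δ X Y) ⟩
  (x xor y) xor (parity X xor parity Y)   ≡⟨ interchange x y (parity X) (parity Y) ⟩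
  (x xor parity X) xor (y xor parity Y)   ∎
  where
    open ≡-Reasoning
    open CommutativeSemigroupProperties (CommutativeRing.+-commutativeSemigroup xor-∧-commutativeRing)
      using (interchange)

parity-Δ-⁅⁆∪⁅⁆ : ∀ {n} {a b : Fin n} (X : Subset n) → a ≢ b →
                 parity (X Δ (⁅ a ⁆ ∪ ⁅ b ⁆)) ≡ parity X
parity-Δ-⁅⁆∪⁅⁆ {a = a} {b} X a≢b = begin
  parity (X Δ (⁅ a ⁆ ∪ ⁅ b ⁆))           ≡⟨ cong (parity ∘ (X Δ_)) (⁅⁆∪⁅⁆≡⁅⁆Δ⁅⁆ a≢b) ⟩
  parity (X Δ (⁅ a ⁆ Δ ⁅ b ⁆))           ≡⟨ parity-Δ X _ ⟩
  parity X xor parity (⁅ a ⁆ Δ ⁅ b ⁆)    ≡⟨ cong (parity X xor_) (parity-Δ ⁅ a ⁆ ⁅ b ⁆) ⟩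
  parity X xor (parity ⁅ a ⁆ xor parity ⁅ b ⁆)
    ≡⟨ cong (parity X xor_) (cong₂ _xor_ (parity-⁅⁆ a) (parity-⁅⁆ b)) ⟩
  parity X xor false                     ≡⟨ xor-identityʳ (parity X) ⟩
  parity X                               ∎
  where open ≡-Reasoning

Family : ℕ → Set
Family n = Subset n → Bool

EvenExchange : ∀ {n} → Family n → Set
EvenExchange f = ∀ A B → f A ≡ true → f B ≡ true → ∀ a → a ∈ (A Δ B) →
  ∃ λ b → b ∈ (A Δ B) × b ≢ a × f (A Δ (⁅ a ⁆ ∪ ⁅ b ⁆)) ≡ true

module _ {n : ℕ} {f : Family n} (evenExchange : EvenExchange f) where

  EvenExchange-resp-≗ : ∀ {g} → (∀ X → f X ≡ g X) → EvenExchange g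
  EvenExchange-resp-≗ f≗g A B gA gB a a∈A-B
    with evenExchange A B (trans (f≗g A) gA) (trans (f≗g B) gB) a a∈A-B
  ... | b , b∈A-B , b≢a , fA′ = b , b∈A-B , b≢a , trans (sym (f≗g _)) fA′

  EvenExchange-Δ : ∀ C → EvenExchange (λ X → f (X Δ C))
  EvenExchange-Δ C A B fA fB a a∈A-B
    with evenExchange (A Δ C) (B Δ C) fA fB a (subst (a ∈_) (sym (Δ-Δ-cancelʳ A B C)) a∈A-B)
  ... | b , b∈ , b≢a , fA′ =
    b , subst (b ∈_) (Δ-Δ-cancelʳ A B C) b∈ , b≢a ,
    subst (λ Z → f Z ≡ true) (Δ-swapʳ A C (⁅ a ⁆ ∪ ⁅ b ⁆)) fA′

  -- Each exchange step moves a basis by two elements, towards the other basis.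
  bases-sameParity : ∀ {A B} → f A ≡ true → f B ≡ true → parity A ≡ parity B
  bases-sameParity {A} {B} fA fB = go A (<-wellFounded ∣ A Δ B ∣) fA
    where
      go : ∀ A → Acc _<_ ∣ A Δ B ∣ → f A ≡ true → parity A ≡ parity B
      go A (acc smaller) fA with nonempty? (A Δ B)
      ... | no  A-B-empty = cong parity (Δ≡⊥⇒≡ (Empty-unique A-B-empty))
      ... | yes (a , a∈A-B) with evenExchange A B fA fB a a∈A-B
      ... | b , b∈A-B , b≢a , fA′ =
        trans (sym (parity-Δ-⁅⁆∪⁅⁆ A (b≢a ∘ sym))) (go _ (smaller closer) fA′)
        where
          closer : ∣ (A Δ (⁅ a ⁆ ∪ ⁅ b ⁆)) Δ B ∣ < ∣ A Δ B ∣
          closer = subst (λ Z → ∣ Z ∣ < ∣ A Δ B ∣) (Δ-swapʳ A B _)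
                     (∣Δ⁅⁆∪⁅⁆∣< a∈A-B b∈A-B (b≢a ∘ sym))

T-⇒ : ∀ {x y} → T (not x ∨ y) → T x → T y
T-⇒ {true} y _ = y

T-maybe : ∀ {A : Set} {p : A → Bool} m → T (maybe p false m) → ∃ λ a → T (p a)
T-maybe (just a) holds = a , holds

allSubsets : ∀ n → (Subset n → Bool) → Bool
allSubsets zero    p = p []
allSubsets (suc n) p = allSubsets n (λ X → p (false ∷ X)) ∧ allSubsets n (λ X → p (true ∷ X))

allSubsets-sound : ∀ n {p : Subset n → Bool} → T (allSubsets n p) → ∀ X → T (p X)
allSubsets-sound zero    holds []          = holds
allSubsets-sound (suc n) holds (false ∷ X) = allSubsets-sound n (proj₁ (Equivalence.to T-∧ holds)) X
allSubsets-sound (suc n) holds (true  ∷ X) = allSubsets-sound n (proj₂ (Equivalence.to T-∧ holds)) X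

branch : ∀ {n} → Family n → Family n → Family (suc n)
branch g h (false ∷ X) = g X
branch g h (true  ∷ X) = h X

-- Runs through the families all of whose members have parity p, up to pointwise equality.
allFamilies : ∀ n (p : Bool) → (Family n → Bool) → Bool
allFamilies zero    false P = P (λ _ → false) ∧ P (λ _ → true)
allFamilies zero    true  P = P (λ _ → false)
allFamilies (suc n) p     P = allFamilies n p λ g → allFamilies n (not p) λ h → P (branch g h)

allFamilies-sound : ∀ n p {P : Family n → Bool} → T (allFamilies n p P) →
  ∀ (f : Family n) → (∀ X → f X ≡ true → parity X ≡ p) → ∃ λ g → (∀ X → g X ≡ f X) × T (P g)
allFamilies-sound zero false holds f _ with f [] in f∅
... | false = (λ _ → false) , (λ { [] → sym f∅ }) , proj₁ (Equivalence.to T-∧ holds)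
... | true  = (λ _ → true)  , (λ { [] → sym f∅ }) , proj₂ (Equivalence.to T-∧ holds)
allFamilies-sound zero true holds f only-odd with f [] in f∅
... | false = (λ _ → false) , (λ { [] → sym f∅ }) , holds
... | true  with () ← only-odd [] f∅
allFamilies-sound (suc n) p holds f parity-p =
  let g , g≗ , holds′ = allFamilies-sound n p holds (λ X → f (false ∷ X)) (parity-p ∘ (false ∷_))
      h , h≗ , holds″ = allFamilies-sound n (not p) holds′ (λ X → f (true ∷ X)) parity-not-p
  in branch g h , (λ { (false ∷ X) → g≗ X ; (true ∷ X) → h≗ X }) , holds″
  where
    parity-not-p : ∀ X → f (true ∷ X) ≡ true → parity X ≡ not p
    parity-not-p X fX = trans (sym (not-involutive (parity X))) (cong not (parity-p (true ∷ X) fX))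

ExchangeInstance : ℕ → Set
ExchangeInstance n = Subset n × Subset n × Fin n

satisfies : ∀ {n} → Family n → ExchangeInstance n → Bool
satisfies {n} f (A , B , a) =
  not (f A ∧ f B ∧ lookup (A Δ B) a) ∨
  any (λ b → lookup (A Δ B) b ∧ not (does (b Fin.≟ a)) ∧ f (A Δ (⁅ a ⁆ ∪ ⁅ b ⁆))) (List.allFin n)

satisfies-sound : ∀ {n} {f : Family n} → EvenExchange f → ∀ e → T (satisfies f e)
satisfies-sound {f = f} evenExchange (A , B , a)
  with f A in fA | f B in fB | lookup (A Δ B) a in a∈A-B
... | false | _     | _     = _
... | true  | false | _     = _
... | true  | true  | false = _
... | true  | true  | true  with evenExchange A B fA fB a (lookup⇒[]= a (A Δ B) a∈A-B)
... | b , b∈A-B , b≢a , fA′ = any⁺ _ (lose (∈-allFin b) witness)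
  where
    witness : T (lookup (A Δ B) b ∧ not (does (b Fin.≟ a)) ∧ f (A Δ (⁅ a ⁆ ∪ ⁅ b ⁆)))
    witness rewrite []=⇒lookup b∈A-B | dec-false (b Fin.≟ a) b≢a | fA′ = _

-- Element i of the subset is bit i of the mask.
fromMask : ∀ {n} → ℕ → Subset n
fromMask {zero}  m = []
fromMask {suc n} m = (m % 2 ≡ᵇ 1) ∷ fromMask (m / 2)

exchange : ∀ {n} → ℕ → ℕ → (a : ℕ) → {True (a <? n)} → ExchangeInstance n
exchange A B a {a<n} = fromMask A , fromMask B , #_ a {m<n = a<n}

-- The integer a - b as the pair (a , b): its image natK a - natK b in a ring is a morphism by
-- ℕ-arithmetic alone.  A data type, not a record, so that sums and products of neutral terms
-- do not unfold (under eta) when expansions are compared.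
data Diff : Set where
  _⊖_ : ℕ → ℕ → Diff

infixl 6 _+ᴰ_
infixl 7 _*ᴰ_

_+ᴰ_ : Diff → Diff → Diff
(a ⊖ b) +ᴰ (c ⊖ d) = (a ℕ.+ c) ⊖ (b ℕ.+ d)

_*ᴰ_ : Diff → Diff → Diff
(a ⊖ b) *ᴰ (c ⊖ d) = (a ℕ.* c ℕ.+ b ℕ.* d) ⊖ (a ℕ.* d ℕ.+ b ℕ.* c)

-ᴰ_ : Diff → Diff
-ᴰ (a ⊖ b) = b ⊖ a

0ᴰ 1ᴰ : Diff
0ᴰ = 0 ⊖ 0
1ᴰ = 1 ⊖ 0

nonzeroᴰ : Diff → Bool
nonzeroᴰ (a ⊖ b) = not (a ≡ᵇ b)

Matrix : ℕ → Set
Matrix n = Fin n → Fin n → Diff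

pfVecᴰ : ∀ {n k} → Matrix n → Vec (Fin n) k → Diff
pfVecᴰ W []           = 1ᴰ
pfVecᴰ W (x ∷ [])     = 0ᴰ
pfVecᴰ W (x ∷ y ∷ ys) =
  sum (λ i → signed i (W x (lookup (y ∷ ys) i) *ᴰ pfVecᴰ W (removeAt (y ∷ ys) i)))
  where
    signed : ∀ {m} → Fin m → Diff → Diff
    signed i d with isEven (toℕ i)
    ... | true  = d
    ... | false = -ᴰ d
    sum : ∀ {m} → (Fin m → Diff) → Diff
    sum {zero}  f = 0ᴰ
    sum {suc m} f = f zero +ᴰ sum (λ i → f (suc i))

elements : ∀ {n} → Subset n → List (Fin n)
elements []          = []
elements (true  ∷ X) = zero ∷ List.map suc (elements X)
elements (false ∷ X) = List.map suc (elements X)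

pfᴰ : ∀ {n} → Matrix n → Subset n → Diff
pfᴰ W X = pfVecᴰ W (Vec.fromList (elements X))

support : ∀ {n} → Matrix n → Family n
support W X = nonzeroᴰ (pfᴰ W X)

represents : ∀ {n} → Family n → Matrix n → Bool
represents {n} f W = allSubsets n (λ X → ⌊ f X ≟ᵇ support W X ⌋)

represents-sound : ∀ {n} {f : Family n} W → T (represents f W) → ∀ X → f X ≡ support W X
represents-sound {n} W holds X = toWitness (allSubsets-sound n holds X)

skewPart : ∀ {n} → Matrix n → Matrix n
skewPart U i j = U i j +ᴰ -ᴰ U j i

-- The code c lists the entries of a strictly upper triangular matrix in row-major order
-- as base 7 digits, the digits 0, 1, …, 6 standing for 0, 1, -1, 2, -2, 3, -3.
upperTriangular : ∀ {n} → ℕ → Matrix n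
upperTriangular         c zero    zero    = 0ᴰ
upperTriangular         c (suc i) zero    = 0ᴰ
upperTriangular         c zero    (suc j) = digit ((c / 7 ^ toℕ j) {{m^n≢0 7 (toℕ j)}} % 7)
  where
    digit : ℕ → Diff
    digit 1 = 1 ⊖ 0
    digit 2 = 0 ⊖ 1
    digit 3 = 2 ⊖ 0
    digit 4 = 0 ⊖ 2
    digit 5 = 3 ⊖ 0
    digit 6 = 0 ⊖ 3
    digit _ = 0ᴰ
upperTriangular {suc n} c (suc i) (suc j) = upperTriangular ((c / 7 ^ n) {{m^n≢0 7 n}}) i j

matrixOf : ∀ {n} → ℕ → Matrix n
matrixOf c = skewPart (upperTriangular c)

truthTable : ∀ {n} → Family n → List Bool
truthTable {zero}  f = f [] ∷ []
truthTable {suc n} f = truthTable (λ X → f (false ∷ X)) List.++ truthTable (λ X → f (true ∷ X))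

data Trie (A : Set) : Set where
  empty : Trie A
  node  : Maybe A → Trie A → Trie A → Trie A

insert : ∀ {A} → List Bool → A → Trie A → Trie A
insert []          a empty        = node (just a) empty empty
insert []          a (node _ l r) = node (just a) l r
insert (false ∷ k) a empty        = node nothing (insert k a empty) empty
insert (true  ∷ k) a empty        = node nothing empty (insert k a empty)
insert (false ∷ k) a (node x l r) = node x (insert k a l) r
insert (true  ∷ k) a (node x l r) = node x l (insert k a r)

find : ∀ {A} → List Bool → Trie A → Maybe A
find _           empty        = nothing
find []          (node x _ _) = x
find (false ∷ k) (node _ l _) = find k l
find (true  ∷ k) (node _ _ r) = find k r

record Certificate (n : ℕ) : Set where
  field
    exchanges : List (ExchangeInstance n)
    matrices  : List ℕ

module _ {n : ℕ} (certificate : Certificate n) where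
  open Certificate certificate

  supportIndex : Trie ℕ
  supportIndex = List.foldr (λ c → insert (truthTable (support {n} (matrixOf c))) c) empty matrices

  -- The index only guides the search, each hit is verified by represents.  It and the instances
  -- are passed as arguments so that they are evaluated only once.
  validWith : Trie ℕ → List (ExchangeInstance n) → Bool
  validWith index instances = allFamilies n false λ f →
    not (f ⊥ ∧ all (satisfies f) instances) ∨
    maybe (λ c → represents f (matrixOf c)) false (find (truthTable f) index)

  valid : Bool
  valid = validWith supportIndex exchanges

  certificate-sound : valid ≡ true → ∀ f → EvenExchange f → f ⊥ ≡ true →
    (∀ X → f X ≡ true → parity X ≡ false) → ∃ λ c → ∀ X → f X ≡ support (matrixOf c) X
  certificate-sound valid≡true f evenExchange f⊥ even =
    let g , g≗f , holds-g = allFamilies-sound n false (Equivalence.from T-≡ valid≡true) f even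
        c , represented   = T-maybe (find (truthTable g) supportIndex)
                                    (T-⇒ holds-g (admissible g g≗f))
    in c , λ X → trans (sym (g≗f X)) (represents-sound (matrixOf c) represented X)
    where
      admissible : ∀ g → (∀ X → g X ≡ f X) → T (g ⊥ ∧ all (satisfies g) exchanges)
      admissible g g≗f rewrite g≗f ⊥ | f⊥ =
        all⁻ _ (All.universal (satisfies-sound (EvenExchange-resp-≗ evenExchange (sym ∘ g≗f)))
                              exchanges)

record ValidCertificate (n : ℕ) : Set where
  field
    certificate : Certificate n
    isValid     : valid certificate ≡ true

module Interpretation {c ℓ} (K : Field c ℓ) where
  open Field K renaming (refl to ≈-refl; sym to ≈-sym; trans to ≈-trans)
  open import Algebra.Properties.Ring ring using ([y-z]x≈yx-zx; x[y-z]≈xy-xz)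
  open AbelianGroupProperties +-abelianGroup using (⁻¹-anti-homo‿-; ⁻¹-∙-comm)
  open GroupProperties +-group using (⁻¹-injective; ε⁻¹≈ε)
  open CommutativeSemigroupProperties +-commutativeSemigroup using (interchange)
  open import Relation.Binary.Reasoning.Setoid setoid

  [x-y]+[z-w]≈[x+z]-[y+w] : ∀ x y z w → (x - y) + (z - w) ≈ (x + z) - (y + w)
  [x-y]+[z-w]≈[x+z]-[y+w] x y z w = ≈-trans (interchange x (- y) z (- w)) (+-congˡ (⁻¹-∙-comm y w))

  [x-y]-[z-w]≈[x+w]-[y+z] : ∀ x y z w → (x - y) - (z - w) ≈ (x + w) - (y + z)
  [x-y]-[z-w]≈[x+w]-[y+z] x y z w =
    ≈-trans (+-congˡ (⁻¹-anti-homo‿- z w)) ([x-y]+[z-w]≈[x+z]-[y+w] x y w z)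

  [x-y][z-w]≈[xz+yw]-[xw+yz] : ∀ x y z w → (x - y) * (z - w) ≈ (x * z + y * w) - (x * w + y * z)
  [x-y][z-w]≈[xz+yw]-[xw+yz] x y z w = begin
    (x - y) * (z - w)                  ≈⟨ [y-z]x≈yx-zx (z - w) x y ⟩
    x * (z - w) - y * (z - w)          ≈⟨ +-cong (x[y-z]≈xy-xz x z w) (-‿cong (x[y-z]≈xy-xz y z w)) ⟩
    (x * z - x * w) - (y * z - y * w)  ≈⟨ [x-y]-[z-w]≈[x+w]-[y+z] (x * z) (x * w) (y * z) (y * w) ⟩
    (x * z + y * w) - (x * w + y * z)  ∎

  natK-+ : ∀ a b → natK K (a ℕ.+ b) ≈ natK K a + natK K b
  natK-+ zero    b = ≈-sym (+-identityˡ _)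
  natK-+ (suc a) b = ≈-trans (+-congˡ (natK-+ a b)) (≈-sym (+-assoc 1# _ _))

  natK-* : ∀ a b → natK K (a ℕ.* b) ≈ natK K a * natK K b
  natK-* zero    b = ≈-sym (zeroˡ _)
  natK-* (suc a) b = begin
    natK K (b ℕ.+ a ℕ.* b)                  ≈⟨ natK-+ b (a ℕ.* b) ⟩
    natK K b + natK K (a ℕ.* b)             ≈⟨ +-cong (≈-sym (*-identityˡ _)) (natK-* a b) ⟩
    1# * natK K b + natK K a * natK K b     ≈⟨ distribʳ (natK K b) 1# (natK K a) ⟨
    (1# + natK K a) * natK K b              ∎

  ⟦_⟧ : Diff → Carrier
  ⟦ a ⊖ b ⟧ = natK K a - natK K b

  ⟦_⟧ᴹ : ∀ {n} → Matrix n → Fin n → Fin n → Carrier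
  ⟦ W ⟧ᴹ i j = ⟦ W i j ⟧

  ⟦+⟧ : ∀ d e → ⟦ d +ᴰ e ⟧ ≈ ⟦ d ⟧ + ⟦ e ⟧
  ⟦+⟧ (a ⊖ b) (c ⊖ d) = ≈-trans (+-cong (natK-+ a c) (-‿cong (natK-+ b d)))
                                 (≈-sym ([x-y]+[z-w]≈[x+z]-[y+w] _ _ _ _))

  ⟦*⟧ : ∀ d e → ⟦ d *ᴰ e ⟧ ≈ ⟦ d ⟧ * ⟦ e ⟧
  ⟦*⟧ (a ⊖ b) (c ⊖ d) = ≈-trans (+-cong (natK-+·* a c b d) (-‿cong (natK-+·* a d b c)))
                                 (≈-sym ([x-y][z-w]≈[xz+yw]-[xw+yz] _ _ _ _))
    where
      natK-+·* : ∀ a b c d →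
                 natK K (a ℕ.* b ℕ.+ c ℕ.* d) ≈ natK K a * natK K b + natK K c * natK K d
      natK-+·* a b c d = ≈-trans (natK-+ (a ℕ.* b) (c ℕ.* d)) (+-cong (natK-* a b) (natK-* c d))

  ⟦-⟧ : ∀ d → ⟦ -ᴰ d ⟧ ≈ - ⟦ d ⟧
  ⟦-⟧ (a ⊖ b) = ≈-sym (⁻¹-anti-homo‿- (natK K a) (natK K b))

  x-0≈x : ∀ x → x - 0# ≈ x
  x-0≈x x = ≈-trans (+-congˡ ε⁻¹≈ε) (+-identityʳ x)

  -- Indexing by d lets Agda read d off the goal when the two Pfaffian expansions are compared.
  infix 4 _↦_
  record _↦_ (d : Diff) (α : Carrier) : Set ℓ where
    constructor evaluates
    field evaluation : ⟦ d ⟧ ≈ α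
  open _↦_

  0↦ : 0ᴰ ↦ 0#
  0↦ = evaluates (-‿inverseʳ 0#)

  1↦ : 1ᴰ ↦ 1#
  1↦ = evaluates (≈-trans (x-0≈x _) (+-identityʳ 1#))

  +↦ : ∀ {d e α β} → d ↦ α → e ↦ β → d +ᴰ e ↦ α + β
  +↦ {d} {e} (evaluates d≈α) (evaluates e≈β) = evaluates (≈-trans (⟦+⟧ d e) (+-cong d≈α e≈β))

  *↦ : ∀ d {e β} → e ↦ β → d *ᴰ e ↦ ⟦ d ⟧ * β
  *↦ d {e} (evaluates e≈β) = evaluates (≈-trans (⟦*⟧ d e) (*-congˡ e≈β))

  -↦ : ∀ {d α} → d ↦ α → -ᴰ d ↦ - α
  -↦ {d} (evaluates d≈α) = evaluates (≈-trans (⟦-⟧ d) (-‿cong d≈α))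

  pfVec-agrees : ∀ {n k} (W : Matrix n) (v : Vec (Fin n) k) → {True (k ≤? 5)} →
                 pfVecᴰ W v ↦ pfVec K ⟦ W ⟧ᴹ v
  pfVec-agrees W []                 = 1↦
  pfVec-agrees W (x ∷ [])           = 0↦
  pfVec-agrees W (x ∷ y ∷ [])       = +↦ (*↦ (W x y) 1↦) 0↦
  pfVec-agrees W (x ∷ y ∷ z ∷ [])   = +↦ (*↦ (W x y) 0↦) (+↦ (-↦ (*↦ (W x z) 0↦)) 0↦)
  pfVec-agrees W (x ∷ y ∷ z ∷ w ∷ []) =
    +↦ (*↦ (W x y) (pfVec-agrees W (z ∷ w ∷ [])))
   (+↦ (-↦ (*↦ (W x z) (pfVec-agrees W (y ∷ w ∷ []))))
   (+↦ (*↦ (W x w) (pfVec-agrees W (y ∷ z ∷ [])))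
       0↦))
  pfVec-agrees W (x ∷ y ∷ z ∷ w ∷ u ∷ []) =
    +↦ (*↦ (W x y) (pfVec-agrees W (z ∷ w ∷ u ∷ [])))
   (+↦ (-↦ (*↦ (W x z) (pfVec-agrees W (y ∷ w ∷ u ∷ []))))
   (+↦ (*↦ (W x w) (pfVec-agrees W (y ∷ z ∷ u ∷ [])))
   (+↦ (-↦ (*↦ (W x u) (pfVec-agrees W (y ∷ z ∷ w ∷ []))))
       0↦)))
  pfVec-agrees W (_ ∷ _ ∷ _ ∷ _ ∷ _ ∷ _ ∷ _) {()}

  pfᴰ-agrees : ∀ {n} (W : Matrix n) X → {True (List.length (elements X) ≤? 5)} →
               pfᴰ W X ↦ pfVec K ⟦ W ⟧ᴹ (Vec.fromList (elements X))
  pfᴰ-agrees W X {≤5} = pfVec-agrees W (Vec.fromList (elements X)) {≤5}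

  -- pf lists the elements of its argument with a local function of Defs, so pf K A X only
  -- unfolds to the right-hand side of pfᴰ-agrees once X is a concrete subset.
  PfAgreement : ℕ → Set ℓ
  PfAgreement n = ∀ (W : Matrix n) X → pfᴰ W X ↦ pf K ⟦ W ⟧ᴹ X

  -x≈0⇒x≈0 : ∀ {x} → - x ≈ 0# → x ≈ 0#
  -x≈0⇒x≈0 -x≈0 = ⁻¹-injective (≈-trans -x≈0 (≈-sym ε⁻¹≈ε))

  ⟦⊖⟧≈0⇒≡ : CharacteristicZero K → ∀ a b → ⟦ a ⊖ b ⟧ ≈ 0# → a ≡ b
  ⟦⊖⟧≈0⇒≡ char0 zero    zero    _     = refl
  ⟦⊖⟧≈0⇒≡ char0 zero    (suc b) 0-b≈0 =
    contradiction⊥ (char0 b (-x≈0⇒x≈0 (≈-trans (≈-sym (+-identityˡ _)) 0-b≈0)))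
  ⟦⊖⟧≈0⇒≡ char0 (suc a) zero    a-0≈0 =
    contradiction⊥ (char0 a (≈-trans (≈-sym (x-0≈x _)) a-0≈0))
  ⟦⊖⟧≈0⇒≡ char0 (suc a) (suc b) a-b≈0 =
    cong suc (⟦⊖⟧≈0⇒≡ char0 a b (≈-trans (≈-sym cancel-1) a-b≈0))
    where
      cancel-1 : (1# + natK K a) - (1# + natK K b) ≈ natK K a - natK K b
      cancel-1 = begin
        (1# + natK K a) - (1# + natK K b)   ≈⟨ [x-y]+[z-w]≈[x+z]-[y+w] 1# 1# (natK K a) (natK K b) ⟨
        (1# - 1#) + (natK K a - natK K b)   ≈⟨ +-congʳ (-‿inverseʳ 1#) ⟩
        0# + (natK K a - natK K b)          ≈⟨ +-identityˡ _ ⟩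
        natK K a - natK K b                 ∎

  nonzeroᴰ⇔ : CharacteristicZero K → ∀ d → (nonzeroᴰ d ≡ true) ⇔ (¬ ⟦ d ⟧ ≈ 0#)
  nonzeroᴰ⇔ char0 (a ⊖ b) with a ≡ᵇ b in a≡ᵇb
  ... | true  = mk⇔ (λ ()) (λ ⟦a⊖a⟧≉0 → contradiction⊥ (⟦a⊖a⟧≉0 ⟦a⊖b⟧≈0))
    where
      ⟦a⊖b⟧≈0 : ⟦ a ⊖ b ⟧ ≈ 0#
      ⟦a⊖b⟧≈0 with refl ← ≡ᵇ⇒≡ a b (subst T (sym a≡ᵇb) tt) = -‿inverseʳ (natK K a)
  ... | false = mk⇔ (λ _ ⟦a⊖b⟧≈0 → subst T a≡ᵇb (≡⇒≡ᵇ a b (⟦⊖⟧≈0⇒≡ char0 a b ⟦a⊖b⟧≈0))) (λ _ → refl)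

  ⟦skewPart⟧ : ∀ {n} (U : Matrix n) i j → ⟦ skewPart U i j ⟧ ≈ ⟦ U i j ⟧ - ⟦ U j i ⟧
  ⟦skewPart⟧ U i j = ≈-trans (⟦+⟧ (U i j) (-ᴰ U j i)) (+-congˡ (⟦-⟧ (U j i)))

  skewPart-skewSymmetric : ∀ {n} (U : Matrix n) → SkewSymmetric K ⟦ skewPart U ⟧ᴹ
  skewPart-skewSymmetric U = antisymmetric , diagonal
    where
      antisymmetric : ∀ i j → ⟦ skewPart U i j ⟧ ≈ - ⟦ skewPart U j i ⟧
      antisymmetric i j = begin
        ⟦ skewPart U i j ⟧           ≈⟨ ⟦skewPart⟧ U i j ⟩
        ⟦ U i j ⟧ - ⟦ U j i ⟧        ≈⟨ ⁻¹-anti-homo‿- ⟦ U j i ⟧ ⟦ U i j ⟧ ⟨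
        - (⟦ U j i ⟧ - ⟦ U i j ⟧)    ≈⟨ -‿cong (⟦skewPart⟧ U j i) ⟨
        - ⟦ skewPart U j i ⟧         ∎
      diagonal : ∀ i → ⟦ skewPart U i i ⟧ ≈ 0#
      diagonal i = ≈-trans (⟦skewPart⟧ U i i) (-‿inverseʳ ⟦ U i i ⟧)

  translation-representable : CharacteristicZero K → ∀ {n} → PfAgreement n → ∀ 𝓑 B₀ (U : Matrix n) →
    (∀ X → 𝓑 (X Δ B₀) ≡ support (skewPart U) X) → RepresentableOver K 𝓑
  translation-representable char0 agrees 𝓑 B₀ U 𝓑[XΔB₀]≡support =
    ∁ B₀ , ⟦ skewPart U ⟧ᴹ , skewPart-skewSymmetric U , λ T → basis⇔ T
    where
      basis⇔ : ∀ T → (𝓑 T ≡ true) ⇔ (¬ pf K ⟦ skewPart U ⟧ᴹ (∁ T Δ ∁ B₀) ≈ 0#)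
      basis⇔ T = mk⇔
        (λ 𝓑T pf≈0 → Equivalence.to nonzero⇔ (trans (sym 𝓑T≡) 𝓑T) (≈-trans agree pf≈0))
        (λ pf≉0 → trans 𝓑T≡ (Equivalence.from nonzero⇔ (pf≉0 ∘ ≈-trans (≈-sym agree))))
        where
          X = ∁ T Δ ∁ B₀
          d = pfᴰ (skewPart U) X
          nonzero⇔ : (nonzeroᴰ d ≡ true) ⇔ (¬ ⟦ d ⟧ ≈ 0#)
          nonzero⇔ = nonzeroᴰ⇔ char0 d
          agree : ⟦ d ⟧ ≈ pf K ⟦ skewPart U ⟧ᴹ X
          agree = evaluation (agrees (skewPart U) X)
          T≡XΔB₀ : T ≡ X Δ B₀
          T≡XΔB₀ = sym (trans (cong (_Δ B₀) (∁-Δ-∁ T B₀)) (Δ-cancelʳ T B₀))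
          𝓑T≡ : 𝓑 T ≡ support (skewPart U) X
          𝓑T≡ = trans (cong 𝓑 T≡XΔB₀) (𝓑[XΔB₀]≡support X)

  representable : CharacteristicZero K → ∀ {n} → ValidCertificate n → PfAgreement n →
    ∀ 𝓑 → IsEvenDeltaMatroid 𝓑 → RepresentableOver K 𝓑
  representable char0 {n} validCertificate agrees 𝓑 (((B₀ , 𝓑B₀) , _) , evenExchange) =
    let c , f≡support = certificate-sound certificate isValid f exchange-f f⊥ even
    in translation-representable char0 agrees 𝓑 B₀ (upperTriangular c) f≡support
    where
      open ValidCertificate validCertificate
      f : Family n
      f X = 𝓑 (X Δ B₀)
      exchange-f : EvenExchange f
      exchange-f = EvenExchange-Δ evenExchange B₀
      f⊥ : f ⊥ ≡ true
      f⊥ = subst (λ Z → 𝓑 Z ≡ true) (sym (Δ-identityˡ B₀)) 𝓑B₀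
      even : ∀ X → f X ≡ true → parity X ≡ false
      even X fX = trans (bases-sameParity exchange-f fX f⊥) (parity-⊥ n)

  pf-agrees₀ : PfAgreement 0
  pf-agrees₀ W X@[] = pfᴰ-agrees W X

  pf-agrees₁ : PfAgreement 1
  pf-agrees₁ W X@(false ∷ []) = pfᴰ-agrees W X
  pf-agrees₁ W X@(true  ∷ []) = pfᴰ-agrees W X

  pf-agrees₂ : PfAgreement 2
  pf-agrees₂ W X@(false ∷ false ∷ []) = pfᴰ-agrees W X
  pf-agrees₂ W X@(true  ∷ false ∷ []) = pfᴰ-agrees W X
  pf-agrees₂ W X@(false ∷ true  ∷ []) = pfᴰ-agrees W X
  pf-agrees₂ W X@(true  ∷ true  ∷ []) = pfᴰ-agrees W X

  pf-agrees₃ : PfAgreement 3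
  pf-agrees₃ W X@(false ∷ false ∷ false ∷ []) = pfᴰ-agrees W X
  pf-agrees₃ W X@(true  ∷ false ∷ false ∷ []) = pfᴰ-agrees W X
  pf-agrees₃ W X@(false ∷ true  ∷ false ∷ []) = pfᴰ-agrees W X
  pf-agrees₃ W X@(true  ∷ true  ∷ false ∷ []) = pfᴰ-agrees W X
  pf-agrees₃ W X@(false ∷ false ∷ true  ∷ []) = pfᴰ-agrees W X
  pf-agrees₃ W X@(true  ∷ false ∷ true  ∷ []) = pfᴰ-agrees W X
  pf-agrees₃ W X@(false ∷ true  ∷ true  ∷ []) = pfᴰ-agrees W X
  pf-agrees₃ W X@(true  ∷ true  ∷ true  ∷ []) = pfᴰ-agrees W X

  pf-agrees₄ : PfAgreement 4
  pf-agrees₄ W X@(false ∷ false ∷ false ∷ false ∷ []) = pfᴰ-agrees W X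
  pf-agrees₄ W X@(true  ∷ false ∷ false ∷ false ∷ []) = pfᴰ-agrees W X
  pf-agrees₄ W X@(false ∷ true  ∷ false ∷ false ∷ []) = pfᴰ-agrees W X
  pf-agrees₄ W X@(true  ∷ true  ∷ false ∷ false ∷ []) = pfᴰ-agrees W X
  pf-agrees₄ W X@(false ∷ false ∷ true  ∷ false ∷ []) = pfᴰ-agrees W X
  pf-agrees₄ W X@(true  ∷ false ∷ true  ∷ false ∷ []) = pfᴰ-agrees W X
  pf-agrees₄ W X@(false ∷ true  ∷ true  ∷ false ∷ []) = pfᴰ-agrees W X
  pf-agrees₄ W X@(true  ∷ true  ∷ true  ∷ false ∷ []) = pfᴰ-agrees W X
  pf-agrees₄ W X@(false ∷ false ∷ false ∷ true  ∷ []) = pfᴰ-agrees W X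
  pf-agrees₄ W X@(true  ∷ false ∷ false ∷ true  ∷ []) = pfᴰ-agrees W X
  pf-agrees₄ W X@(false ∷ true  ∷ false ∷ true  ∷ []) = pfᴰ-agrees W X
  pf-agrees₄ W X@(true  ∷ true  ∷ false ∷ true  ∷ []) = pfᴰ-agrees W X
  pf-agrees₄ W X@(false ∷ false ∷ true  ∷ true  ∷ []) = pfᴰ-agrees W X
  pf-agrees₄ W X@(true  ∷ false ∷ true  ∷ true  ∷ []) = pfᴰ-agrees W X
  pf-agrees₄ W X@(false ∷ true  ∷ true  ∷ true  ∷ []) = pfᴰ-agrees W X
  pf-agrees₄ W X@(true  ∷ true  ∷ true  ∷ true  ∷ []) = pfᴰ-agrees W X

  pf-agrees₅ : PfAgreement 5
  pf-agrees₅ W X@(false ∷ false ∷ false ∷ false ∷ false ∷ []) = pfᴰ-agrees W X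
  pf-agrees₅ W X@(true  ∷ false ∷ false ∷ false ∷ false ∷ []) = pfᴰ-agrees W X
  pf-agrees₅ W X@(false ∷ true  ∷ false ∷ false ∷ false ∷ []) = pfᴰ-agrees W X
  pf-agrees₅ W X@(true  ∷ true  ∷ false ∷ false ∷ false ∷ []) = pfᴰ-agrees W X
  pf-agrees₅ W X@(false ∷ false ∷ true  ∷ false ∷ false ∷ []) = pfᴰ-agrees W X
  pf-agrees₅ W X@(true  ∷ false ∷ true  ∷ false ∷ false ∷ []) = pfᴰ-agrees W X
  pf-agrees₅ W X@(false ∷ true  ∷ true  ∷ false ∷ false ∷ []) = pfᴰ-agrees W X
  pf-agrees₅ W X@(true  ∷ true  ∷ true  ∷ false ∷ false ∷ []) = pfᴰ-agrees W X
  pf-agrees₅ W X@(false ∷ false ∷ false ∷ true  ∷ false ∷ []) = pfᴰ-agrees W X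
  pf-agrees₅ W X@(true  ∷ false ∷ false ∷ true  ∷ false ∷ []) = pfᴰ-agrees W X
  pf-agrees₅ W X@(false ∷ true  ∷ false ∷ true  ∷ false ∷ []) = pfᴰ-agrees W X
  pf-agrees₅ W X@(true  ∷ true  ∷ false ∷ true  ∷ false ∷ []) = pfᴰ-agrees W X
  pf-agrees₅ W X@(false ∷ false ∷ true  ∷ true  ∷ false ∷ []) = pfᴰ-agrees W X
  pf-agrees₅ W X@(true  ∷ false ∷ true  ∷ true  ∷ false ∷ []) = pfᴰ-agrees W X
  pf-agrees₅ W X@(false ∷ true  ∷ true  ∷ true  ∷ false ∷ []) = pfᴰ-agrees W X
  pf-agrees₅ W X@(true  ∷ true  ∷ true  ∷ true  ∷ false ∷ []) = pfᴰ-agrees W X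
  pf-agrees₅ W X@(false ∷ false ∷ false ∷ false ∷ true  ∷ []) = pfᴰ-agrees W X
  pf-agrees₅ W X@(true  ∷ false ∷ false ∷ false ∷ true  ∷ []) = pfᴰ-agrees W X
  pf-agrees₅ W X@(false ∷ true  ∷ false ∷ false ∷ true  ∷ []) = pfᴰ-agrees W X
  pf-agrees₅ W X@(true  ∷ true  ∷ false ∷ false ∷ true  ∷ []) = pfᴰ-agrees W X
  pf-agrees₅ W X@(false ∷ false ∷ true  ∷ false ∷ true  ∷ []) = pfᴰ-agrees W X
  pf-agrees₅ W X@(true  ∷ false ∷ true  ∷ false ∷ true  ∷ []) = pfᴰ-agrees W X
  pf-agrees₅ W X@(false ∷ true  ∷ true  ∷ false ∷ true  ∷ []) = pfᴰ-agrees W X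
  pf-agrees₅ W X@(true  ∷ true  ∷ true  ∷ false ∷ true  ∷ []) = pfᴰ-agrees W X
  pf-agrees₅ W X@(false ∷ false ∷ false ∷ true  ∷ true  ∷ []) = pfᴰ-agrees W X
  pf-agrees₅ W X@(true  ∷ false ∷ false ∷ true  ∷ true  ∷ []) = pfᴰ-agrees W X
  pf-agrees₅ W X@(false ∷ true  ∷ false ∷ true  ∷ true  ∷ []) = pfᴰ-agrees W X
  pf-agrees₅ W X@(true  ∷ true  ∷ false ∷ true  ∷ true  ∷ []) = pfᴰ-agrees W X
  pf-agrees₅ W X@(false ∷ false ∷ true  ∷ true  ∷ true  ∷ []) = pfᴰ-agrees W X
  pf-agrees₅ W X@(true  ∷ false ∷ true  ∷ true  ∷ true  ∷ []) = pfᴰ-agrees W X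
  pf-agrees₅ W X@(false ∷ true  ∷ true  ∷ true  ∷ true  ∷ []) = pfᴰ-agrees W X
  pf-agrees₅ W X@(true  ∷ true  ∷ true  ∷ true  ∷ true  ∷ []) = pfᴰ-agrees W X

certificate₀ : Certificate 0
certificate₀ = record
  { exchanges = []
  ; matrices  = 0 ∷ []
  }

validCertificate₀ : ValidCertificate 0
validCertificate₀ = record { certificate = certificate₀ ; isValid = refl }

certificate₁ : Certificate 1
certificate₁ = record
  { exchanges = []
  ; matrices  = 0 ∷ []
  }

validCertificate₁ : ValidCertificate 1
validCertificate₁ = record { certificate = certificate₁ ; isValid = refl }

certificate₂ : Certificate 2
certificate₂ = record
  { exchanges = []
  ; matrices  = 0 ∷ 2 ∷ []
  }

validCertificate₂ : ValidCertificate 2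
validCertificate₂ = record { certificate = certificate₂ ; isValid = refl }

certificate₃ : Certificate 3
certificate₃ = record
  { exchanges = []
  ; matrices  = 0 ∷ 196 ∷ 7 ∷ 238 ∷ 5 ∷ 200 ∷ 10 ∷ 205 ∷ []
  }

validCertificate₃ : ValidCertificate 3
validCertificate₃ = record { certificate = certificate₃ ; isValid = refl }

certificate₄ : Certificate 4
certificate₄ = record
  { exchanges =
      exchange 0 15 0 ∷ exchange 15 0 0 ∷ exchange 3 12 2 ∷ exchange 5 10 1 ∷
      exchange 6 9 0 ∷ exchange 0 15 1 ∷ exchange 0 15 2 ∷ exchange 0 15 3 ∷
      exchange 3 12 3 ∷ exchange 5 10 3 ∷ exchange 6 9 3 ∷ exchange 9 6 1 ∷ exchange 9 6 2 ∷
      exchange 10 5 0 ∷ exchange 10 5 2 ∷ exchange 12 3 0 ∷ exchange 12 3 1 ∷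
      exchange 15 0 1 ∷ exchange 15 0 2 ∷ exchange 15 0 3 ∷ []
  ; matrices  =
      0 ∷ 16807 ∷ 4802 ∷ 108045 ∷ 49 ∷ 17003 ∷ 2695 ∷ 24157 ∷ 1029 ∷ 17836 ∷ 13377 ∷ 80948 ∷
      980 ∷ 85848 ∷ 15288 ∷ 21511 ∷ 28 ∷ 33649 ∷ 7231 ∷ 74473 ∷ 315 ∷ 84168 ∷ 14476 ∷
      96166 ∷ 2065 ∷ 68292 ∷ 11340 ∷ 58002 ∷ 1505 ∷ 84539 ∷ 5432 ∷ 16730 ∷ 76020 ∷ 26173 ∷
      1 ∷ 100846 ∷ 4808 ∷ 74437 ∷ 202 ∷ 84186 ∷ 14702 ∷ 112948 ∷ 344 ∷ 85755 ∷ 7895 ∷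
      47335 ∷ 641 ∷ 50961 ∷ 52187 ∷ 7060 ∷ 62235 ∷ 38812 ∷ 39 ∷ 33654 ∷ 12034 ∷ 57664 ∷
      52833 ∷ 86 ∷ 67407 ∷ 12344 ∷ 24126 ∷ 26482 ∷ 1384 ∷ 101540 ∷ 4149 ∷ 24363 ∷ 71382 ∷
      1166 ∷ 101796 ∷ 34127 ∷ 16411 ∷ 15958 ∷ 114983 ∷ 28281 ∷ []
  }

validCertificate₄ : ValidCertificate 4
validCertificate₄ = record { certificate = certificate₄ ; isValid = refl }

certificate₅ : Certificate 5
certificate₅ = record
  { exchanges =
      exchange 0 15 0 ∷ exchange 0 23 4 ∷ exchange 0 30 3 ∷ exchange 0 27 1 ∷
      exchange 0 29 2 ∷ exchange 27 0 1 ∷ exchange 15 0 0 ∷ exchange 23 0 4 ∷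
      exchange 3 12 2 ∷ exchange 5 10 1 ∷ exchange 29 6 1 ∷ exchange 12 17 4 ∷
      exchange 24 5 0 ∷ exchange 9 20 4 ∷ exchange 3 30 4 ∷ exchange 15 18 4 ∷
      exchange 23 24 3 ∷ exchange 10 20 4 ∷ exchange 0 30 2 ∷ exchange 6 9 0 ∷
      exchange 29 18 2 ∷ exchange 27 20 2 ∷ exchange 6 17 4 ∷ exchange 3 24 3 ∷
      exchange 17 10 3 ∷ exchange 5 18 4 ∷ exchange 0 30 1 ∷ exchange 12 18 1 ∷
      exchange 10 20 2 ∷ exchange 6 24 3 ∷ exchange 30 9 0 ∷ exchange 0 29 0 ∷
      exchange 17 15 1 ∷ exchange 5 10 3 ∷ exchange 0 27 3 ∷ exchange 12 17 0 ∷
      exchange 9 20 2 ∷ exchange 23 0 1 ∷ exchange 27 0 3 ∷ exchange 20 3 1 ∷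
      exchange 29 0 0 ∷ exchange 9 18 1 ∷ exchange 24 5 2 ∷ exchange 24 23 1 ∷
      exchange 20 3 0 ∷ exchange 12 18 4 ∷ exchange 0 30 4 ∷ exchange 15 0 2 ∷
      exchange 27 5 2 ∷ exchange 15 0 1 ∷ exchange 3 12 3 ∷ exchange 15 18 3 ∷
      exchange 23 0 0 ∷ exchange 6 9 3 ∷ exchange 6 24 4 ∷ exchange 23 10 2 ∷
      exchange 17 6 2 ∷ exchange 23 12 3 ∷ exchange 29 10 1 ∷ exchange 27 0 0 ∷
      exchange 5 30 1 ∷ exchange 3 24 4 ∷ exchange 29 0 4 ∷ exchange 17 6 1 ∷
      exchange 27 5 4 ∷ exchange 18 9 3 ∷ exchange 29 0 3 ∷ exchange 18 9 0 ∷
      exchange 15 17 4 ∷ exchange 18 12 2 ∷ exchange 20 10 3 ∷ exchange 30 9 1 ∷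
      exchange 10 17 0 ∷ exchange 18 5 0 ∷ exchange 15 20 3 ∷ exchange 0 23 0 ∷
      exchange 29 3 2 ∷ exchange 9 6 2 ∷ exchange 17 12 2 ∷ exchange 9 6 1 ∷
      exchange 5 24 3 ∷ exchange 30 17 2 ∷ exchange 30 3 4 ∷ exchange 12 3 0 ∷
      exchange 0 23 1 ∷ exchange 0 27 0 ∷ exchange 3 20 4 ∷ exchange 5 24 4 ∷
      exchange 20 9 0 ∷ exchange 17 12 3 ∷ exchange 0 15 2 ∷ exchange 0 29 3 ∷
      exchange 0 29 4 ∷ exchange 10 5 2 ∷ exchange 24 6 2 ∷ exchange 18 12 3 ∷
      exchange 24 6 1 ∷ exchange 30 5 3 ∷ exchange 6 17 0 ∷ exchange 29 3 1 ∷
      exchange 20 10 1 ∷ exchange 30 3 2 ∷ exchange 0 23 2 ∷ exchange 0 27 4 ∷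
      exchange 0 15 3 ∷ exchange 0 15 1 ∷ exchange 9 23 4 ∷ exchange 12 27 1 ∷
      exchange 18 29 2 ∷ exchange 10 23 0 ∷ exchange 20 15 3 ∷ exchange 3 29 2 ∷
      exchange 5 30 4 ∷ exchange 10 29 4 ∷ exchange 23 0 2 ∷ exchange 24 15 0 ∷
      exchange 30 0 4 ∷ exchange 10 29 0 ∷ exchange 30 0 3 ∷ exchange 5 27 1 ∷
      exchange 9 30 4 ∷ exchange 12 23 1 ∷ exchange 18 15 2 ∷ exchange 20 27 3 ∷
      exchange 24 15 1 ∷ exchange 30 0 1 ∷ exchange 3 29 4 ∷ exchange 3 30 3 ∷
      exchange 5 27 3 ∷ exchange 5 27 4 ∷ exchange 5 30 3 ∷ exchange 6 27 4 ∷
      exchange 6 29 3 ∷ exchange 9 23 2 ∷ exchange 12 23 4 ∷ exchange 17 15 2 ∷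
      exchange 27 0 4 ∷ exchange 10 17 4 ∷ exchange 30 0 2 ∷ exchange 30 3 0 ∷
      exchange 15 0 3 ∷ exchange 3 20 2 ∷ exchange 5 18 1 ∷ exchange 17 10 1 ∷
      exchange 24 3 0 ∷ exchange 29 0 2 ∷ exchange 10 5 0 ∷ exchange 12 3 1 ∷
      exchange 20 9 3 ∷ exchange 9 18 4 ∷ exchange 15 20 4 ∷ exchange 18 5 2 ∷
      exchange 23 9 3 ∷ exchange 24 3 1 ∷ exchange 27 6 2 ∷ exchange 30 5 0 ∷ []
  ; matrices  =
      0 ∷ 242121642 ∷ 17294403 ∷ 138355224 ∷ 117649 ∷ 121766715 ∷ 12000198 ∷ 253768893 ∷
      1372 ∷ 121062193 ∷ 23061262 ∷ 155650999 ∷ 588588 ∷ 80825206 ∷ 29412593 ∷ 98355250 ∷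
      1647086 ∷ 43647779 ∷ 13176688 ∷ 187767804 ∷ 3058874 ∷ 125060887 ∷ 17059105 ∷
      187532506 ∷ 1648115 ∷ 205064265 ∷ 33765606 ∷ 49413952 ∷ 5531561 ∷ 125886145 ∷
      20002388 ∷ 198828182 ∷ 67228 ∷ 201818456 ∷ 11546409 ∷ 213314444 ∷ 756315 ∷ 161632919 ∷
      29210566 ∷ 132808914 ∷ 18865 ∷ 40387907 ∷ 5783323 ∷ 196087955 ∷ 724759 ∷ 121229234 ∷
      11748436 ∷ 110272442 ∷ 2554664 ∷ 203465542 ∷ 19042331 ∷ 59328710 ∷ 4789995 ∷
      82757668 ∷ 26218920 ∷ 11479181 ∷ 177381078 ∷ 155229452 ∷ 3312351 ∷ 124457550 ∷
      10775002 ∷ 49446537 ∷ 1985284 ∷ 204559712 ∷ 21984928 ∷ 11194491 ∷ 60387894 ∷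
      256273479 ∷ 49 ∷ 121060919 ∷ 34588953 ∷ 270945745 ∷ 117698 ∷ 161885171 ∷ 35059549 ∷
      167532470 ∷ 2205 ∷ 80708880 ∷ 11531807 ∷ 144122181 ∷ 236572 ∷ 40472579 ∷ 6472949 ∷
      46237478 ∷ 823788 ∷ 203415268 ∷ 26353474 ∷ 250357268 ∷ 3059021 ∷ 243180630 ∷ 7647332 ∷
      100236997 ∷ 4119871 ∷ 81531639 ∷ 13178648 ∷ 35413966 ∷ 275888424 ∷ 224005215 ∷
      3882956 ∷ 165650576 ∷ 22942878 ∷ 30237606 ∷ 235299960 ∷ 240005724 ∷ 50715 ∷ 80741024 ∷
      11597075 ∷ 126842674 ∷ 655620 ∷ 162019774 ∷ 11832275 ∷ 237163626 ∷ 35427 ∷ 201853148 ∷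
      34690040 ∷ 230695185 ∷ 303016 ∷ 607159 ∷ 121802093 ∷ 161936719 ∷ 6203449 ∷ 17833501 ∷
      155802899 ∷ 127515836 ∷ 2504537 ∷ 164759070 ∷ 12387004 ∷ 177145976 ∷ 4504472 ∷
      243953752 ∷ 32068050 ∷ 19227453 ∷ 270559331 ∷ 145498395 ∷ 1665902 ∷ 245484806 ∷
      30573746 ∷ 13228628 ∷ 168071568 ∷ 133448462 ∷ 5513970 ∷ 976472 ∷ 246207752 ∷
      244761321 ∷ 13311536 ∷ 26909330 ∷ 16421076 ∷ 33346950 ∷ 32639978 ∷ 67112703 ∷
      214660964 ∷ 168289275 ∷ 142171687 ∷ 269198846 ∷ 9604 ∷ 242133647 ∷ 17296804 ∷
      51897615 ∷ 477799 ∷ 121543422 ∷ 34948956 ∷ 150369828 ∷ 16121 ∷ 242135362 ∷ 23069494 ∷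
      270949420 ∷ 121765 ∷ 81311923 ∷ 6011075 ∷ 265428835 ∷ 4132121 ∷ 202596380 ∷ 21416920 ∷
      151541516 ∷ 2240133 ∷ 246359407 ∷ 166720638 ∷ 25191292 ∷ 98945210 ∷ 111898605 ∷
      1651202 ∷ 164722663 ∷ 10720122 ∷ 51071328 ∷ 1885814 ∷ 124956272 ∷ 41768139 ∷
      24827369 ∷ 169771623 ∷ 180955481 ∷ 96040 ∷ 201816055 ∷ 17385641 ∷ 46156824 ∷
      144230471 ∷ 564235 ∷ 40754574 ∷ 17527300 ∷ 133012999 ∷ 184735341 ∷ 113533 ∷ 40458222 ∷
      11576936 ∷ 184493869 ∷ 51940490 ∷ 138915 ∷ 242501343 ∷ 12330507 ∷ 92432669 ∷
      260160698 ∷ 2559466 ∷ 166446924 ∷ 8264242 ∷ 145017999 ∷ 90647354 ∷ 2230529 ∷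
      207136671 ∷ 42380051 ∷ 30259803 ∷ 30456685 ∷ 55515922 ∷ 141613381 ∷ 5050332 ∷
      242998350 ∷ 18160135 ∷ 258700204 ∷ 211743504 ∷ 3930780 ∷ 246857786 ∷ 124768651 ∷
      33623261 ∷ 22923719 ∷ 192638747 ∷ 106938482 ∷ 9800 ∷ 242126738 ∷ 11532297 ∷
      190253084 ∷ 365148 ∷ 121779014 ∷ 6127646 ∷ 104359514 ∷ 13622 ∷ 80718386 ∷ 34602085 ∷
      167185893 ∷ 126714 ∷ 40477626 ∷ 12016466 ∷ 69770414 ∷ 4127564 ∷ 42834085 ∷ 28014966 ∷
      237187881 ∷ 3061373 ∷ 246359456 ∷ 85310176 ∷ 20242978 ∷ 104830208 ∷ 129181199 ∷
      4956105 ∷ 203431438 ∷ 33778787 ∷ 9065049 ∷ 60131036 ∷ 199303139 ∷ 4240558 ∷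
      163421517 ∷ 164480309 ∷ 30125102 ∷ 19540955 ∷ 142131605 ∷ 210594993 ∷ 66126480 ∷
      231657349 ∷ 60074 ∷ 121152255 ∷ 23124276 ∷ 247975574 ∷ 224858746 ∷ 233191 ∷
      161882868 ∷ 17628191 ∷ 271555648 ∷ 167472249 ∷ 37240 ∷ 242169172 ∷ 17394314 ∷
      69207943 ∷ 276783115 ∷ 822318 ∷ 626416 ∷ 121204440 ∷ 40806122 ∷ 29445227 ∷ 29406370 ∷
      231083265 ∷ 69930889 ∷ 265625521 ∷ 150519670 ∷ 1762432 ∷ 202656454 ∷ 14883848 ∷
      275947077 ∷ 278465873 ∷ 1500723 ∷ 123200210 ∷ 123925361 ∷ 30401609 ∷ 11044894 ∷
      185674377 ∷ 66582376 ∷ 3407950 ∷ 41231589 ∷ 26406590 ∷ 21512764 ∷ 106261498 ∷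
      64350622 ∷ 149137674 ∷ 191139739 ∷ 3523198 ∷ 1996064 ∷ 246564423 ∷ 164589775 ∷
      165289397 ∷ 44037917 ∷ 20046733 ∷ 15608754 ∷ 8039773 ∷ 10940867 ∷ 31151064 ∷
      195614174 ∷ 137794909 ∷ 71268148 ∷ 175296961 ∷ 145965071 ∷ 177277688 ∷ 130416636 ∷
      35 ∷ 40353649 ∷ 23059232 ∷ 184473674 ∷ 352954 ∷ 40471263 ∷ 6353074 ∷ 46824344 ∷ 1743 ∷
      201768413 ∷ 28824369 ∷ 178709531 ∷ 353647 ∷ 161885409 ∷ 23177910 ∷ 213416007 ∷
      3294179 ∷ 205062249 ∷ 39530099 ∷ 191885554 ∷ 1294153 ∷ 167061601 ∷ 33412344 ∷
      146120065 ∷ 4942651 ∷ 243770793 ∷ 125178914 ∷ 22237404 ∷ 112826098 ∷ 71649291 ∷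
      4472727 ∷ 42120442 ∷ 247298562 ∷ 39413136 ∷ 76003347 ∷ 268829372 ∷ 50435 ∷ 80724049 ∷
      5798450 ∷ 253701700 ∷ 268954 ∷ 242793929 ∷ 6252218 ∷ 98791553 ∷ 85792 ∷ 242190263 ∷
      17362688 ∷ 190272425 ∷ 152299 ∷ 40557048 ∷ 11966962 ∷ 167954094 ∷ 1663921 ∷
      244609120 ∷ 7445522 ∷ 137615751 ∷ 3983280 ∷ 206205104 ∷ 25781980 ∷ 24605469 ∷
      209163150 ∷ 151347042 ∷ 1665986 ∷ 81599385 ∷ 84069664 ∷ 37111592 ∷ 55261780 ∷
      128508387 ∷ 5362833 ∷ 85834070 ∷ 166322786 ∷ 16673580 ∷ 11277861 ∷ 100741872 ∷
      95430860 ∷ 80019163 ∷ 261635948 ∷ 322 ∷ 161414603 ∷ 23059407 ∷ 236356904 ∷ 207533158 ∷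
      470813 ∷ 242357157 ∷ 23412305 ∷ 271416530 ∷ 196120995 ∷ 413 ∷ 121061577 ∷ 23061444 ∷
      172945612 ∷ 247888683 ∷ 707763 ∷ 202475707 ∷ 17884937 ∷ 178944801 ∷ 87062409 ∷
      823676 ∷ 244592439 ∷ 39530204 ∷ 154826322 ∷ 199297623 ∷ 1411949 ∷ 85413230 ∷
      11059125 ∷ 76471983 ∷ 263181044 ∷ 3294690 ∷ 245418187 ∷ 41178753 ∷ 27178543 ∷
      22236977 ∷ 98825566 ∷ 258594063 ∷ 1412243 ∷ 245770987 ∷ 44001209 ∷ 34237896 ∷
      20706749 ∷ 97884388 ∷ 189297668 ∷ 33698 ∷ 121077894 ∷ 34673051 ∷ 178809890 ∷
      155733837 ∷ 554785 ∷ 242642750 ∷ 23849301 ∷ 236609233 ∷ 184641891 ∷ 52346 ∷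
      242206251 ∷ 11599105 ∷ 270996859 ∷ 86524333 ∷ 674653 ∷ 387156 ∷ 121599856 ∷ 81129559 ∷
      6454637 ∷ 6455736 ∷ 46506397 ∷ 92608047 ∷ 109734023 ∷ 46574045 ∷ 4958373 ∷ 204322930 ∷
      32219159 ∷ 146624485 ∷ 113699523 ∷ 3445540 ∷ 85228381 ∷ 25950323 ∷ 19244253 ∷
      131985581 ∷ 129851036 ∷ 185784809 ∷ 185818395 ∷ 857962 ∷ 163130170 ∷ 247148293 ∷
      28052185 ∷ 29749594 ∷ 280090797 ∷ 186188758 ∷ 975261 ∷ 4725084 ∷ 164675434 ∷
      244895700 ∷ 166878355 ∷ 245568288 ∷ 7396263 ∷ 30372398 ∷ 37010820 ∷ 8540168 ∷
      39463452 ∷ 48321749 ∷ 227988215 ∷ 261855370 ∷ 119835275 ∷ 65279305 ∷ 275736762 ∷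
      200289894 ∷ 14434 ∷ 242133675 ∷ 5772039 ∷ 155652056 ∷ 249746 ∷ 201895295 ∷ 11884978 ∷
      138840233 ∷ 3472 ∷ 161418565 ∷ 5769967 ∷ 253653995 ∷ 600600 ∷ 81186406 ∷ 358470 ∷
      202369321 ∷ 35307062 ∷ 139076224 ∷ 29066184 ∷ 150125654 ∷ 830767 ∷ 164720626 ∷
      20590983 ∷ 76599145 ∷ 3896844 ∷ 41779829 ∷ 166602996 ∷ 17068751 ∷ 180713701 ∷
      195535053 ∷ 1651587 ∷ 165542811 ∷ 124371464 ∷ 33778682 ∷ 53536497 ∷ 279185235 ∷
      4595871 ∷ 164606057 ∷ 43768179 ∷ 5545988 ∷ 82122803 ∷ 44603741 ∷ 82487426 ∷ 9777929 ∷
      149427299 ∷ 118951042 ∷ 20008226 ∷ 267893661 ∷ 201312909 ∷ 72832991 ∷ 45661 ∷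
      80822497 ∷ 11553619 ∷ 144218473 ∷ 271053720 ∷ 196917 ∷ 201964931 ∷ 35265930 ∷
      179527586 ∷ 185167542 ∷ 62090 ∷ 80778222 ∷ 28913556 ∷ 103811372 ∷ 63486906 ∷ 769377 ∷
      40820465 ∷ 436660 ∷ 121875124 ∷ 23694468 ∷ 277297356 ∷ 150109176 ∷ 23675589 ∷
      179437398 ∷ 58024659 ∷ 1685516 ∷ 85710933 ∷ 38749746 ∷ 275922941 ∷ 139243615 ∷
      3224550 ∷ 164382078 ∷ 81842901 ∷ 13150305 ∷ 27690775 ∷ 88448066 ∷ 111375215 ∷
      1704388 ∷ 247124318 ∷ 81555831 ∷ 18196864 ∷ 49489776 ∷ 224040061 ∷ 223272455 ∷
      53579694 ∷ 5522650 ∷ 164553235 ∷ 84790664 ∷ 1174453 ∷ 41840519 ∷ 165255699 ∷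
      41629917 ∷ 7003073 ∷ 11368399 ∷ 67747337 ∷ 228620168 ∷ 143107503 ∷ 26230596 ∷
      13910043 ∷ 141573257 ∷ 100969617 ∷ 209489007 ∷ 239875027 ∷ 5110 ∷ 161421946 ∷
      28833777 ∷ 98008939 ∷ 224829899 ∷ 242704 ∷ 161899752 ∷ 23767569 ∷ 253778749 ∷
      52476508 ∷ 11550 ∷ 242125002 ∷ 5780754 ∷ 172955559 ∷ 207537078 ∷ 592417 ∷ 202371288 ∷
      714735 ∷ 202131482 ∷ 23299143 ∷ 265420183 ∷ 133188153 ∷ 23545683 ∷ 52597664 ∷
      58242891 ∷ 3306408 ∷ 202598956 ∷ 31302096 ∷ 146605277 ∷ 99651377 ∷ 4002775 ∷
      247300809 ∷ 45777802 ∷ 36365882 ∷ 180007947 ∷ 60831806 ∷ 250126632 ∷ 137776807 ∷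
      1661086 ∷ 123535153 ∷ 45308543 ∷ 12359186 ∷ 37066435 ∷ 112830942 ∷ 268485595 ∷
      2831976 ∷ 165188639 ∷ 167074740 ∷ 4711896 ∷ 164953390 ∷ 83303612 ∷ 244483253 ∷
      39309116 ∷ 13533170 ∷ 62006322 ∷ 64600396 ∷ 118009619 ∷ 13303507 ∷ 40246416 ∷
      61898802 ∷ 251301806 ∷ 189899129 ∷ 210712670 ∷ 40894 ∷ 161486612 ∷ 17316299 ∷
      276748976 ∷ 138396160 ∷ 398699 ∷ 202277215 ∷ 12310032 ∷ 144821180 ∷ 208315674 ∷
      39158 ∷ 40428668 ∷ 23120244 ∷ 276731539 ∷ 190314110 ∷ 200151 ∷ 162048019 ∷ 352828 ∷
      81217024 ∷ 11960123 ∷ 138667865 ∷ 207976293 ∷ 17644095 ∷ 185042095 ∷ 208058522 ∷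
      74655 ∷ 40449878 ∷ 17383345 ∷ 57686496 ∷ 276748934 ∷ 51962708 ∷ 686952 ∷ 242313911 ∷
      5942531 ∷ 184918041 ∷ 277178951 ∷ 236774916 ∷ 32368 ∷ 242201428 ∷ 11562523 ∷
      132648593 ∷ 46216226 ∷ 184517809 ∷ 516110 ∷ 162034873 ∷ 755692 ∷ 221459 ∷ 81446449 ∷
      242940257 ∷ 17946670 ∷ 57786365 ∷ 271515797 ∷ 167615462 ∷ 23437645 ∷ 29510110 ∷
      132780648 ∷ 156199869 ∷ 173558455 ∷ 184969834 ∷ 179122727 ∷ 133148057 ∷ 3351964 ∷
      122777697 ∷ 23974251 ∷ 227391822 ∷ 249629681 ∷ 2809429 ∷ 42668360 ∷ 203837858 ∷
      33078913 ∷ 22144500 ∷ 97903232 ∷ 169371629 ∷ 71163540 ∷ 4998700 ∷ 123612972 ∷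
      42844466 ∷ 7507857 ∷ 18179672 ∷ 257061119 ∷ 101322963 ∷ 281688925 ∷ 2725590 ∷
      124560072 ∷ 245625709 ∷ 4608772 ∷ 243523392 ∷ 125679456 ∷ 125409781 ∷ 25794713 ∷
      10443279 ∷ 56162260 ∷ 271952583 ∷ 20021533 ∷ 12608218 ∷ 18546115 ∷ 235978148 ∷
      259034888 ∷ 263413430 ∷ 3354281 ∷ 126043120 ∷ 26447092 ∷ 238906766 ∷ 52767085 ∷
      90613908 ∷ 1448111 ∷ 83439615 ∷ 126206248 ∷ 15004080 ∷ 17236912 ∷ 142984464 ∷
      200846289 ∷ 105687323 ∷ 209813961 ∷ 1711451 ∷ 163963233 ∷ 126067417 ∷ 12437124 ∷
      19035737 ∷ 180379171 ∷ 182024052 ∷ 143412507 ∷ 271851685 ∷ 5406989 ∷ 82148612 ∷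
      86298583 ∷ 2322978 ∷ 3122560 ∷ 246990268 ∷ 164434067 ∷ 124068105 ∷ 164190628 ∷
      164658039 ∷ 81690651 ∷ 16332246 ∷ 25216737 ∷ 7963172 ∷ 112638904 ∷ 267531831 ∷
      255443342 ∷ 7269430 ∷ 15221395 ∷ 39919845 ∷ 8107673 ∷ 31588893 ∷ 71222004 ∷
      197629159 ∷ 272388032 ∷ 140380905 ∷ 146796244 ∷ 141026452 ∷ 64816353 ∷ 2 ∷ 242121643 ∷
      23059206 ∷ 259416050 ∷ 470598 ∷ 40471257 ∷ 6000102 ∷ 237062736 ∷ 1373 ∷ 40355328 ∷
      34590868 ∷ 236358904 ∷ 235990 ∷ 81179869 ∷ 29059995 ∷ 150120471 ∷ 823549 ∷ 125178538 ∷
      19765034 ∷ 67530532 ∷ 4235366 ∷ 42941887 ∷ 13764934 ∷ 223415457 ∷ 2472348 ∷ 41177497 ∷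
      16472236 ∷ 281652398 ∷ 1295855 ∷ 166826626 ∷ 22001738 ∷ 172828099 ∷ 100846 ∷
      121111246 ∷ 23160048 ∷ 213381676 ∷ 756318 ∷ 242289714 ∷ 34874529 ∷ 265601027 ∷ 50768 ∷
      161465193 ∷ 161498811 ∷ 34623109 ∷ 51918199 ∷ 46136250 ∷ 791990 ∷ 81195649 ∷
      121280687 ∷ 29027407 ∷ 265519049 ∷ 213938366 ∷ 1680702 ∷ 244609081 ∷ 38790561 ∷
      174675155 ∷ 2134491 ∷ 81665214 ∷ 26319768 ∷ 17042300 ∷ 154809279 ∷ 187112333 ∷
      1698881 ∷ 205971506 ∷ 202626223 ∷ 14858075 ∷ 150793781 ∷ 271837450 ∷ 5278087 ∷
      166777924 ∷ 203114312 ∷ 33614349 ∷ 29834488 ∷ 111902726 ∷ 279452048 ∷ 263501176 ∷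
      158323315 ∷ 200 ∷ 80707265 ∷ 17294605 ∷ 224827489 ∷ 353002 ∷ 80942762 ∷ 40706658 ∷
      17882798 ∷ 219768483 ∷ 254239689 ∷ 590 ∷ 40354004 ∷ 11530733 ∷ 196003877 ∷ 707709 ∷
      242829501 ∷ 162004784 ∷ 12236233 ∷ 86708542 ∷ 173298109 ∷ 823642 ∷ 247063199 ∷
      37883131 ∷ 254475037 ∷ 4235660 ∷ 162708817 ∷ 41883096 ∷ 20471224 ∷ 200591695 ∷
      47059802 ∷ 4119335 ∷ 242947539 ∷ 7412626 ∷ 38707701 ∷ 52707493 ∷ 277535660 ∷ 1531304 ∷
      245651701 ∷ 43883716 ∷ 20707450 ∷ 6707906 ∷ 133767649 ∷ 256005989 ∷ 108356351 ∷
      71178139 ∷ 101039 ∷ 161481857 ∷ 5781904 ∷ 207583505 ∷ 689338 ∷ 80993183 ∷ 161582745 ∷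
      11832425 ∷ 260206024 ∷ 92438648 ∷ 85849 ∷ 242190980 ∷ 242207445 ∷ 23111146 ∷
      247955635 ∷ 259450203 ∷ 404548 ∷ 404304 ∷ 161802171 ∷ 121313565 ∷ 17715315 ∷ 6035919 ∷
      173348381 ∷ 237113747 ∷ 3378360 ∷ 165599568 ∷ 30488100 ∷ 261113654 ∷ 3546476 ∷
      245096779 ∷ 126153593 ∷ 9243902 ∷ 33715041 ∷ 242105086 ∷ 79682091 ∷ 128455953 ∷
      118489449 ∷ 4168921 ∷ 45312164 ∷ 206726885 ∷ 14858275 ∷ 33834310 ∷ 62624208 ∷
      75816920 ∷ 137616310 ∷ 180373804 ∷ 5615108 ∷ 5514466 ∷ 165935955 ∷ 122305275 ∷
      8203045 ∷ 24874851 ∷ 14152332 ∷ 13446144 ∷ 36608004 ∷ 105246563 ∷ 168810494 ∷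
      59850463 ∷ 101550198 ∷ 108994673 ∷ 254996790 ∷ 171601680 ∷ 4808 ∷ 80714421 ∷
      17308815 ∷ 138364832 ∷ 122456 ∷ 81417911 ∷ 29417058 ∷ 178951333 ∷ 15093 ∷ 40366646 ∷
      11541955 ∷ 74948932 ∷ 11536123 ∷ 224840960 ∷ 248338 ∷ 121305041 ∷ 29542937 ∷
      265304328 ∷ 11663721 ∷ 52246104 ∷ 4132125 ∷ 43659789 ∷ 39534869 ∷ 127658771 ∷
      4240168 ∷ 206603652 ∷ 125894039 ∷ 14365184 ∷ 252244261 ∷ 227074581 ∷ 831095 ∷
      206722332 ∷ 26361955 ∷ 112018318 ∷ 24716586 ∷ 67539790 ∷ 3533590 ∷ 204838573 ∷
      45066433 ∷ 18364568 ∷ 215536745 ∷ 48359229 ∷ 36957568 ∷ 227897436 ∷ 73654454 ∷ 69635 ∷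
      242198476 ∷ 17320819 ∷ 144232876 ∷ 207609671 ∷ 681885 ∷ 201916903 ∷ 11985794 ∷
      230824938 ∷ 127577140 ∷ 73749 ∷ 242238265 ∷ 201883630 ∷ 5827576 ∷ 184570706 ∷
      230657899 ∷ 17406565 ∷ 75058353 ∷ 63439913 ∷ 92312624 ∷ 428751 ∷ 40685294 ∷
      202219086 ∷ 6058070 ∷ 196321199 ∷ 57843179 ∷ 23819980 ∷ 115929546 ∷ 115463748 ∷
      190498088 ∷ 2497042 ∷ 243010014 ∷ 21517766 ∷ 107103810 ∷ 87365189 ∷ 1253328 ∷
      85091441 ∷ 41909461 ∷ 7275034 ∷ 36027008 ∷ 175940482 ∷ 113377622 ∷ 4181518 ∷
      206001686 ∷ 163905640 ∷ 31399936 ∷ 98867352 ∷ 210093334 ∷ 19826435 ∷ 197692168 ∷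
      50353431 ∷ 195223942 ∷ 4760843 ∷ 247576372 ∷ 125690979 ∷ 247643605 ∷ 42732313 ∷
      13721035 ∷ 25722257 ∷ 199831804 ∷ 254848662 ∷ 108617813 ∷ 7670169 ∷ 14549376 ∷
      276164737 ∷ 263979665 ∷ 201111537 ∷ 101735521 ∷ 7306 ∷ 121070671 ∷ 23064208 ∷
      144134726 ∷ 482802 ∷ 121545874 ∷ 41061956 ∷ 23417200 ∷ 196248334 ∷ 150593270 ∷ 8336 ∷
      161422514 ∷ 5772645 ∷ 57659235 ∷ 23074052 ∷ 155663054 ∷ 364806 ∷ 40479195 ∷ 80948933 ∷
      17423621 ∷ 127418478 ∷ 271430605 ∷ 6364270 ∷ 230843020 ∷ 277191042 ∷ 4130019 ∷
      247065547 ∷ 9894620 ∷ 61773177 ∷ 3068528 ∷ 126367181 ∷ 45892963 ∷ 32478477 ∷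
      187304510 ∷ 47897652 ∷ 826781 ∷ 124368179 ∷ 22244484 ∷ 151538528 ∷ 9895163 ∷
      240489948 ∷ 4246981 ∷ 123185414 ∷ 85069442 ∷ 9179857 ∷ 212013693 ∷ 276254995 ∷
      8832006 ∷ 136486712 ∷ 270724119 ∷ 4955913 ∷ 43655180 ∷ 9887369 ∷ 187782407 ∷ 1774539 ∷
      245663363 ∷ 84128888 ∷ 41650447 ∷ 19073743 ∷ 239418266 ∷ 158838402 ∷ 72592129 ∷
      4133940 ∷ 203418407 ∷ 23893580 ∷ 146598987 ∷ 19768218 ∷ 13190704 ∷ 210834751 ∷
      78244279 ∷ 1778310 ∷ 43062577 ∷ 164833408 ∷ 83651287 ∷ 40242526 ∷ 220607904 ∷
      149427760 ∷ 49180615 ∷ 39427265 ∷ 10239339 ∷ 116251031 ∷ 279423138 ∷ 66012216 ∷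
      222958870 ∷ 47305046 ∷ 220254513 ∷ 89087 ∷ 80753079 ∷ 17354531 ∷ 224935486 ∷
      46192889 ∷ 797186 ∷ 80851425 ∷ 202183463 ∷ 35290048 ∷ 52060983 ∷ 92779544 ∷ 52452541 ∷
      259639389 ∷ 57087 ∷ 161461469 ∷ 201879805 ∷ 23079982 ∷ 276826335 ∷ 86504165 ∷
      17327581 ∷ 57677412 ∷ 74975834 ∷ 155762083 ∷ 157295 ∷ 340310 ∷ 121409903 ∷ 40627128 ∷
      29102084 ∷ 17672784 ∷ 138565682 ∷ 126998303 ∷ 219755055 ∷ 29108896 ∷ 11728299 ∷
      138766633 ∷ 150668046 ∷ 104379068 ∷ 58343029 ∷ 2562166 ∷ 202627844 ∷ 35491685 ∷
      275176408 ∷ 227329233 ∷ 3716946 ∷ 82609056 ∷ 207141623 ∷ 20742437 ∷ 16396677 ∷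
      181350128 ∷ 72059111 ∷ 112441428 ∷ 3407857 ∷ 43708689 ∷ 203485686 ∷ 12443504 ∷
      51175556 ∷ 73405727 ∷ 25624894 ∷ 211734050 ∷ 95628209 ∷ 114569353 ∷ 5474723 ∷
      5453948 ∷ 82542314 ∷ 125564461 ∷ 86085067 ∷ 19915075 ∷ 21259684 ∷ 140517549 ∷
      272971800 ∷ 10503739 ∷ 9251496 ∷ 25842949 ∷ 209810751 ∷ 187136146 ∷ 128613932 ∷
      1762531 ∷ 243845712 ∷ 29753344 ∷ 189530190 ∷ 177967123 ∷ 3589793 ∷ 126614486 ∷
      43873621 ∷ 247610477 ∷ 37722211 ∷ 17169847 ∷ 90090622 ∷ 47146186 ∷ 49943350 ∷
      54301215 ∷ 4231987 ∷ 84878195 ∷ 162316475 ∷ 19053900 ∷ 68396753 ∷ 173858327 ∷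
      27284183 ∷ 16513836 ∷ 279223807 ∷ 120285107 ∷ 88218769 ∷ 47879567 ∷ 148298897 ∷
      280870600 ∷ 3289323 ∷ 4428622 ∷ 125679417 ∷ 123412190 ∷ 247476412 ∷ 44676931 ∷
      12759700 ∷ 34559359 ∷ 33595774 ∷ 80039542 ∷ 148027189 ∷ 47511434 ∷ 33765216 ∷
      16427104 ∷ 10565383 ∷ 13583442 ∷ 16079209 ∷ 155573534 ∷ 282027785 ∷ 169981984 ∷
      235354013 ∷ 141843489 ∷ 181339447 ∷ 136327805 ∷ 22 ∷ 121060832 ∷ 23059217 ∷
      276710494 ∷ 705906 ∷ 40588936 ∷ 35177098 ∷ 196591494 ∷ 12117877 ∷ 132825768 ∷ 1415 ∷
      161416509 ∷ 34589167 ∷ 69179373 ∷ 590313 ∷ 202358012 ∷ 35179134 ∷ 179416124 ∷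
      17530742 ∷ 196710194 ∷ 2470644 ∷ 122707934 ∷ 21412162 ∷ 90589776 ∷ 4823641 ∷
      247298245 ∷ 32471170 ∷ 181532415 ∷ 36824164 ∷ 186591331 ∷ 1648816 ∷ 247063594 ∷
      42825620 ∷ 33766987 ∷ 198474916 ∷ 211652293 ∷ 4825714 ∷ 124945340 ∷ 162357366 ∷
      14236909 ∷ 169062994 ∷ 48826065 ∷ 32706794 ∷ 234476545 ∷ 279652400 ∷ 100889 ∷
      201818489 ∷ 23109671 ∷ 224877696 ∷ 319369 ∷ 81228262 ∷ 6437101 ∷ 259987514 ∷
      35210685 ∷ 265466613 ∷ 35705 ∷ 40387586 ∷ 80759040 ∷ 23127165 ∷ 115314217 ∷
      138439965 ∷ 185572 ∷ 202575817 ∷ 41162411 ∷ 35227824 ∷ 219398950 ∷ 277349498 ∷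
      23698232 ∷ 277502118 ∷ 69564533 ∷ 840398 ∷ 243785582 ∷ 14050684 ∷ 186977904 ∷
      5311055 ∷ 82152631 ∷ 26050890 ∷ 264811132 ∷ 20185238 ∷ 131666082 ∷ 2504609 ∷
      41195018 ∷ 84859952 ∷ 6623698 ∷ 185348986 ∷ 182071954 ∷ 4371571 ∷ 206088830 ∷
      203112956 ∷ 21111005 ∷ 182424574 ∷ 154542468 ∷ 27615313 ∷ 94373067 ∷ 174492372 ∷
      890818 ∷ 45395718 ∷ 38756952 ∷ 140893097 ∷ 4084110 ∷ 165801071 ∷ 30269447 ∷
      183129101 ∷ 30387089 ∷ 10975011 ∷ 110959861 ∷ 134893014 ∷ 2555722 ∷ 165583638 ∷
      82406484 ∷ 81633345 ∷ 14035265 ∷ 227382611 ∷ 100489423 ∷ 186155044 ∷ 2017219 ∷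
      164877049 ∷ 43849829 ∷ 86052206 ∷ 15934767 ∷ 251736292 ∷ 120960705 ∷ 191482532 ∷
      36976801 ∷ 25750392 ∷ 195701059 ∷ 192205928 ∷ 214543090 ∷ 193316216 ∷ 66405503 ∷
      95011027 ∷ 67 ∷ 121061123 ∷ 28824340 ∷ 253651497 ∷ 115296215 ∷ 353201 ∷ 121414053 ∷
      161649893 ∷ 17765177 ∷ 52118800 ∷ 58118882 ∷ 23647728 ∷ 248239674 ∷ 196474016 ∷
      150002801 ∷ 631 ∷ 121063209 ∷ 23061179 ∷ 57649855 ∷ 224829408 ∷ 236325 ∷ 161769767 ∷
      242829054 ∷ 29179342 ∷ 219652726 ∷ 265535343 ∷ 5883755 ∷ 208122231 ∷ 184593056 ∷
      116004207 ∷ 3294289 ∷ 84001495 ∷ 25529958 ∷ 75766094 ∷ 217415637 ∷ 3176597 ∷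
      247651379 ∷ 206591921 ∷ 10823863 ∷ 156591052 ∷ 189768015 ∷ 7647328 ∷ 214709603 ∷
      57295352 ∷ 221297906 ∷ 4120075 ∷ 43648295 ∷ 166356264 ∷ 20589836 ∷ 7413687 ∷
      150709967 ∷ 116121403 ∷ 2002001 ∷ 82590441 ∷ 205769814 ∷ 244711953 ∷ 203180567 ∷
      14236370 ∷ 16590745 ∷ 213182016 ∷ 120002854 ∷ 224710793 ∷ 33177420 ∷ 21059742 ∷
      210358389 ∷ 215651489 ∷ 238241107 ∷ 216123156 ∷ 67408 ∷ 161515358 ∷ 5832206 ∷
      86522726 ∷ 51950558 ∷ 554944 ∷ 81430011 ∷ 121850859 ∷ 6218894 ∷ 213482774 ∷
      236962153 ∷ 17933305 ∷ 167700374 ∷ 115800371 ∷ 265433036 ∷ 102093 ∷ 80775264 ∷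
      242156262 ∷ 34690917 ∷ 219147772 ∷ 86507972 ∷ 138457663 ∷ 184541529 ∷ 689559 ∷
      489292 ∷ 40538968 ∷ 162105415 ∷ 17816686 ∷ 11868044 ∷ 173382493 ∷ 144609249 ∷
      69952284 ∷ 12338325 ∷ 12035346 ∷ 115548955 ∷ 265972107 ∷ 191030654 ∷ 87112600 ∷
      5008777 ∷ 45345527 ∷ 29714891 ∷ 208440671 ∷ 131834195 ∷ 4756525 ∷ 44790834 ∷
      82018478 ∷ 39496703 ∷ 94892435 ∷ 53799370 ∷ 40034514 ∷ 192373029 ∷ 236037789 ∷
      281147642 ∷ 3380151 ∷ 246342053 ∷ 126105313 ∷ 14051207 ∷ 13194735 ∷ 130154655 ∷
      90607847 ∷ 103045742 ∷ 3010062 ∷ 5195213 ∷ 245097386 ∷ 246846756 ∷ 85431830 ∷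
      38859830 ∷ 31934475 ∷ 106927288 ∷ 269013397 ∷ 19077528 ∷ 10572222 ∷ 28656961 ∷
      96222020 ∷ 281988858 ∷ 227013294 ∷ 2521214 ∷ 82438515 ∷ 30521643 ∷ 141750467 ∷
      98859014 ∷ 4605182 ∷ 204037201 ∷ 206138189 ∷ 6924678 ∷ 212222300 ∷ 146221062 ∷
      25950346 ∷ 15832472 ∷ 148221141 ∷ 149750536 ∷ 240424357 ∷ 272878562 ∷ 221197139 ∷
      194860418 ∷ 4203748 ∷ 163937703 ∷ 247165748 ∷ 126036471 ∷ 32976158 ∷ 15716523 ∷
      102960426 ∷ 154037241 ∷ 47834646 ∷ 239685525 ∷ 3967276 ∷ 1043841 ∷ 163466028 ∷
      206962890 ∷ 203013918 ∷ 162643241 ∷ 18270464 ∷ 26723945 ∷ 38305152 ∷ 74674765 ∷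
      89665750 ∷ 193518191 ∷ 21279992 ∷ 9800274 ∷ 39027122 ∷ 20304779 ∷ 7699406 ∷
      136305632 ∷ 73565113 ∷ 49682496 ∷ 187633902 ∷ 281232456 ∷ 264105818 ∷ 252308594 ∷
      4838 ∷ 80721643 ∷ 28836021 ∷ 265195285 ∷ 485012 ∷ 201897730 ∷ 11896966 ∷ 103893700 ∷
      29421881 ∷ 213537754 ∷ 16491 ∷ 121072150 ∷ 5768951 ∷ 172951621 ∷ 11543335 ∷
      276718002 ∷ 719297 ∷ 40595109 ∷ 358468 ∷ 161772879 ∷ 23310311 ∷ 248244569 ∷ 6130821 ∷
      254124599 ∷ 4946094 ∷ 162249984 ∷ 18951124 ∷ 145779150 ∷ 4475502 ∷ 207069486 ∷
      82712093 ∷ 32002944 ∷ 67662610 ∷ 252133828 ∷ 15421649 ∷ 226243876 ∷ 230484039 ∷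
      2484033 ∷ 204252415 ∷ 83192608 ∷ 28008044 ∷ 93075121 ∷ 117780037 ∷ 23890340 ∷
      99655604 ∷ 258603488 ∷ 1188190 ∷ 41415543 ∷ 83540755 ∷ 3064065 ∷ 207420691 ∷
      123063972 ∷ 122250026 ∷ 6832241 ∷ 252956716 ∷ 194252584 ∷ 127899573 ∷ 30003620 ∷
      94123000 ∷ 77305352 ∷ 211543210 ∷ 112363065 ∷ 72070 ∷ 161512913 ∷ 28864863 ∷
      230630497 ∷ 92277663 ∷ 388993 ∷ 40793015 ∷ 11911378 ∷ 138902661 ∷ 98654715 ∷
      35172275 ∷ 75458672 ∷ 190384904 ∷ 91614 ∷ 121120180 ∷ 121098917 ∷ 11586588 ∷
      51905858 ∷ 196052329 ∷ 34681778 ∷ 178790824 ∷ 253738060 ∷ 46145893 ∷ 621216 ∷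
      121592143 ∷ 201979697 ∷ 531696 ∷ 161669985 ∷ 162074055 ∷ 6212797 ∷ 46937525 ∷
      110270402 ∷ 87236930 ∷ 17668635 ∷ 231318866 ∷ 230939862 ∷ 277414997 ∷ 207850477 ∷
      2542668 ∷ 244633111 ∷ 8312303 ∷ 148336205 ∷ 60181113 ∷ 4919681 ∷ 207239959 ∷
      43585369 ∷ 10228291 ∷ 68092376 ∷ 30334254 ∷ 175830064 ∷ 178461536 ∷ 2582823 ∷
      84894940 ∷ 125284564 ∷ 37138356 ∷ 227393256 ∷ 70115730 ∷ 14060950 ∷ 181226480 ∷
      238026923 ∷ 159858931 ∷ 4678185 ∷ 165255023 ∷ 43336707 ∷ 3015338 ∷ 83961286 ∷
      162731572 ∷ 203915583 ∷ 31123837 ∷ 120554934 ∷ 155507640 ∷ 38670897 ∷ 26669973 ∷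
      276155174 ∷ 48975285 ∷ 261268944 ∷ 4141734 ∷ 203477571 ∷ 14105894 ∷ 192773906 ∷
      266047645 ∷ 1404623 ∷ 246426653 ∷ 83679685 ∷ 30098974 ∷ 53792028 ∷ 88462485 ∷
      34029414 ∷ 24161287 ∷ 255788177 ∷ 254647697 ∷ 5033878 ∷ 42025090 ∷ 124437332 ∷
      205905673 ∷ 15720055 ∷ 96375501 ∷ 212494705 ∷ 59404523 ∷ 22293652 ∷ 186194137 ∷
      135954927 ∷ 75848288 ∷ 250461728 ∷ 154082142 ∷ 4782131 ∷ 166202716 ∷ 164623568 ∷
      42999874 ∷ 1987035 ∷ 125144262 ∷ 84382485 ∷ 82515530 ∷ 124612613 ∷ 205339049 ∷
      6731406 ∷ 32465672 ∷ 135059720 ∷ 187990458 ∷ 168261094 ∷ 145295168 ∷ 36981253 ∷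
      25472600 ∷ 132572599 ∷ 181317712 ∷ 221930977 ∷ 275756256 ∷ 145368228 ∷ 98997698 ∷
      9678 ∷ 201770698 ∷ 28831528 ∷ 51897836 ∷ 253663524 ∷ 485082 ∷ 161899622 ∷ 202010817 ∷
      29539838 ∷ 271548518 ∷ 156007519 ∷ 29073866 ∷ 92709950 ∷ 167426736 ∷ 219192328 ∷
      15300 ∷ 242133049 ∷ 17300908 ∷ 92242361 ∷ 276726348 ∷ 11534279 ∷ 138367800 ∷
      224837987 ∷ 482401 ∷ 202490686 ∷ 161891410 ∷ 127752 ∷ 81302059 ∷ 40715091 ∷ 5886773 ∷
      254248129 ∷ 132714066 ∷ 184712629 ∷ 12015726 ∷ 196362541 ∷ 271539857 ∷ 178842548 ∷
      184960883 ∷ 2477990 ∷ 41189265 ∷ 27188989 ∷ 140016778 ∷ 263548337 ∷ 4362907 ∷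
      125661450 ∷ 203895450 ∷ 8831184 ∷ 90719677 ∷ 149308657 ∷ 15537149 ∷ 68483780 ∷
      88719419 ∷ 137659218 ∷ 4130914 ∷ 163065208 ∷ 242948008 ∷ 21418237 ∷ 266020242 ∷
      25534188 ∷ 238839396 ∷ 159782969 ∷ 3419788 ∷ 246841508 ∷ 164605202 ∷ 3777975 ∷
      124716171 ∷ 124601446 ∷ 166124491 ∷ 36125345 ∷ 153779821 ∷ 266959390 ∷ 16356573 ∷
      28122508 ∷ 68604867 ∷ 169777675 ∷ 266598650 ∷ 2482951 ∷ 124362361 ∷ 19774952 ∷
      148242606 ∷ 119416415 ∷ 1894561 ∷ 86248846 ∷ 247665786 ∷ 122014324 ∷ 13419425 ∷
      157064053 ∷ 61897859 ∷ 282367269 ∷ 25414867 ∷ 236124165 ∷ 264480032 ∷ 143896848 ∷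
      168478364 ∷ 136946108 ∷ 828760 ∷ 125184511 ∷ 121890939 ∷ 18951689 ∷ 156486986 ∷
      177065142 ∷ 20592230 ∷ 13185519 ∷ 104597751 ∷ 59306375 ∷ 4365939 ∷ 41898555 ∷
      82958544 ∷ 126126583 ∷ 1776454 ∷ 246366254 ∷ 125652848 ∷ 203897289 ∷ 247783051 ∷
      84601044 ∷ 39306681 ∷ 19062212 ∷ 188130177 ∷ 100949143 ∷ 223543175 ∷ 78594228 ∷
      30955838 ∷ 16709429 ∷ 227076625 ∷ 143425690 ∷ 237890715 ∷ 67311920 ∷ 251895197 ∷
      216370020 ∷ 24137 ∷ 242196365 ∷ 5868349 ∷ 230668933 ∷ 270984345 ∷ 766137 ∷ 81333937 ∷
      121291381 ∷ 6341352 ∷ 127015456 ∷ 248160384 ∷ 17988605 ∷ 104234728 ∷ 271373355 ∷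
      64222213 ∷ 39044 ∷ 161476004 ∷ 201788674 ∷ 28941373 ∷ 271045639 ∷ 190354649 ∷
      23137234 ∷ 224942093 ∷ 144220747 ∷ 69283853 ∷ 207477 ∷ 40608569 ∷ 467041 ∷ 202057740 ∷
      242885564 ∷ 6346456 ∷ 179057728 ∷ 225007191 ∷ 11982696 ∷ 17610886 ∷ 46905141 ∷
      179255453 ∷ 75258167 ∷ 55478 ∷ 40406761 ∷ 23102519 ∷ 236419376 ∷ 138374701 ∷
      126849904 ∷ 703702 ∷ 202402013 ∷ 41114940 ∷ 35330992 ∷ 144631658 ∷ 127466995 ∷
      138917154 ∷ 6048282 ∷ 236822918 ∷ 225242895 ∷ 271495699 ∷ 104398048 ∷ 58262998 ∷
      97235 ∷ 40403417 ∷ 80731663 ∷ 11595393 ∷ 155729948 ∷ 92261284 ∷ 75023976 ∷ 5848064 ∷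
      144185414 ∷ 247948312 ∷ 92283805 ∷ 144233498 ∷ 144226287 ∷ 214121 ∷ 40697469 ∷
      161739764 ∷ 276545 ∷ 533648 ∷ 202444419 ∷ 81491916 ∷ 17635978 ∷ 34733969 ∷ 109707480 ∷
      69411627 ∷ 52179880 ∷ 46871719 ∷ 35126547 ∷ 11915590 ∷ 231058801 ∷ 190788781 ∷
      110169428 ∷ 144258885 ∷ 64029732 ∷ 52025954 ∷ 1740929 ∷ 41213241 ∷ 14922311 ∷
      208467082 ∷ 279200594 ∷ 275973603 ∷ 982200 ∷ 204980914 ∷ 43960117 ∷ 205609903 ∷
      30416154 ∷ 282295515 ∷ 54843946 ∷ 13047190 ∷ 14754259 ∷ 197292850 ∷ 239355798 ∷
      118196555 ∷ 251814543 ∷ 2528807 ∷ 126042030 ∷ 164769131 ∷ 44585130 ∷ 21459352 ∷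
      79931192 ∷ 143410574 ∷ 24786616 ∷ 22301806 ∷ 224103624 ∷ 171336124 ∷ 281768740 ∷
      250401199 ∷ 5744348 ∷ 82627423 ∷ 124550140 ∷ 2783654 ∷ 1269311 ∷ 86424395 ∷
      164170529 ∷ 164417868 ∷ 162646608 ∷ 31205228 ∷ 38325212 ∷ 93451157 ∷ 254619399 ∷
      37316829 ∷ 8076597 ∷ 6729549 ∷ 24412609 ∷ 136033113 ∷ 93452647 ∷ 217102502 ∷
      154588940 ∷ 2576431 ∷ 45357575 ∷ 33861561 ∷ 180430641 ∷ 280909854 ∷ 189492031 ∷
      112852039 ∷ 3640111 ∷ 205691533 ∷ 125505249 ∷ 123927849 ∷ 85434905 ∷ 9258313 ∷
      35955315 ∷ 210291839 ∷ 136864512 ∷ 193523228 ∷ 34459426 ∷ 21258590 ∷ 257452296 ∷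
      170970543 ∷ 145366254 ∷ 48867614 ∷ 113315427 ∷ 68995328 ∷ 3382186 ∷ 162337649 ∷
      85698084 ∷ 81634647 ∷ 205175456 ∷ 14853123 ∷ 19795208 ∷ 187003731 ∷ 191100141 ∷
      79929251 ∷ 10742736 ∷ 24795607 ∷ 239676999 ∷ 130999506 ∷ 156539807 ∷ 129374642 ∷
      229054156 ∷ 112084912 ∷ 5107413 ∷ 5146241 ∷ 124884155 ∷ 82884329 ∷ 162463461 ∷
      5742350 ∷ 3493045 ∷ 247032836 ∷ 41964467 ∷ 244085654 ∷ 204029296 ∷ 123148309 ∷
      162708400 ∷ 11154349 ∷ 24563680 ∷ 14996178 ∷ 15986276 ∷ 267338187 ∷ 106516713 ∷
      229294959 ∷ 152314528 ∷ 38968158 ∷ 19618993 ∷ 25863192 ∷ 36047224 ∷ 37843773 ∷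
      201358238 ∷ 67687467 ∷ 215296632 ∷ 65475042 ∷ 99810820 ∷ 141403382 ∷ 189341315 ∷ []
  }

validCertificate₅ : ValidCertificate 5
validCertificate₅ = record { certificate = certificate₅ ; isValid = refl }

mainTheorem2 : ∀ {c ℓ : Level} (K : Field c ℓ) → CharacteristicZero K → AlgebraicallyClosed K →
    ∀ (n : ℕ) → n ≤ 5 → (𝓑 : Subset n → Bool) → IsEvenDeltaMatroid 𝓑 → RepresentableOver K 𝓑
mainTheorem2 K char0 _ = λ where
    0 _ → representable char0 validCertificate₀ pf-agrees₀
    1 _ → representable char0 validCertificate₁ pf-agrees₁
    2 _ → representable char0 validCertificate₂ pf-agrees₂
    3 _ → representable char0 validCertificate₃ pf-agrees₃
    4 _ → representable char0 validCertificate₄ pf-agrees₄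
    5 _ → representable char0 validCertificate₅ pf-agrees₅
    (suc (suc (suc (suc (suc (suc _)))))) (s≤s (s≤s (s≤s (s≤s (s≤s ())))))
  where open Interpretation K
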